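{- Let $t\leq m$ be positive integers and let $(\mathbb{F}_{2^m},+,\star)$ be a left pre-quasifield. Let $\gamma,\tau,h:\mathbb{F}_{2^m}\to\mathbb{F}_{2^t}$ and $\sigma:\mathbb{F}_{2^m}\to\mathbb{F}_{2^m}$ be maps such that $\gamma$ is balanced, $\tau$ is surjective and $\mathbb{F}_2$-linear, $\sigma$ is invertible, and $h$ is arbitrary. Define $f_1,f_2:\mathbb{F}_{2^m}\times\mathbb{F}_{2^m}\to\mathbb{F}_{2^t}$ by \[ f_1(x,y)=\gamma\Big(\star\tfrac{x}{y}\Big),\qquad f_2(x,y)=\tau\big(\sigma(y)\star x\big)+h(y). \] Then \[ d_H(f_1,\mathcal{A})=d_H(f_2,\mathcal{A})=\Big(1-\frac{1}{2^t}\Big)\big(2^{2m}-2^m\big). \]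
   Context: A left pre-quasifield is a triple $(Q,+,\star)$ where $(Q,+)$ is a finite abelian group and $\star:Q\times Q\to Q$ satisfies: (1) $x\star 0=0\star x=0$ for all $x$; (2) $x\star(y+z)=x\star y+x\star z$ for all $x,y,z$; (3) for every $a\neq 0$ the maps $x\mapsto x\star a$ and $x\mapsto a\star x$ are bijections of $Q$. Here $(Q,+)$ is the additive group of $\mathbb{F}_{2^m}$. The right division is defined by $\star\frac{x}{y}=a$ if $y\neq 0$ and $x=a\star y$, and $\star\frac{x}{y}=0$ if $y=0$. A map $g:A\to B$ between finite sets is balanced if $|g^{ -1}(b)|=|A|/|B|$ for all $b\in B$. For functions $f,g:A\to B$, the Hamming distance $d_H(f,g)$ is the number of $a\in A$ with $f(a)\neq g(a)$. The domain $\mathbb{F}_{2^m}\times\mathbb{F}_{2^m}$ is viewed as the $\mathbb{F}_2$-vector space $\mathbb{F}_2^{2m}$ and $\mathbb{F}_{2^t}$ as $\mathbb{F}_2^t$; $\mathcal{A}$ denotes the set of affine maps (an $\mathbb{F}_2$-linear map plus a constant) from the domain to $\mathbb{F}_{2^t}$, and $d_H(f,\mathcal{A})=\min_{A\in\mathcal{A}}d_H(f,A)$. -}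

module Defs where

open import Data.Bool using (Bool; true; false; _xor_; _∧_; if_then_else_)
open import Data.Nat using (ℕ; zero; suc; _*_; _^_; _∸_; _≤_)
open import Data.Vec using (Vec; []; _∷_; zipWith; replicate; map)
open import Data.Vec.Properties using (≡-dec)
open import Data.Bool.Properties using () renaming (_≟_ to _≟B_)
open import Data.List using (List; []; _∷_; length; filter; concatMap; cartesianProduct)
import Data.List as L
open import Data.Product using (_×_; _,_; ∃; Σ; proj₁; proj₂)
open import Relation.Binary.PropositionalEquality using (_≡_; _≢_)
open import Relation.Nullary using (Dec; yes; no; ¬_)
open import Relation.Nullary.Decidable using (¬?)
open import Function.Definitions using (Bijective)

-- The additive group of F_{2^n} is (F_2^n, ⊕); we represent it as bit vectors.
-- (Only the additive / F_2-vector-space structure of F_{2^m}, F_{2^t} is used.)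
Bits : ℕ → Set
Bits n = Vec Bool n

infixl 6 _⊕_
_⊕_ : ∀ {n} → Bits n → Bits n → Bits n
_⊕_ = zipWith _xor_

𝟘 : ∀ {n} → Bits n
𝟘 = replicate _ false

_·_ : ∀ {n} → Bool → Bits n → Bits n
b · v = map (b ∧_) v

_≟_ : ∀ {n} → (u v : Bits n) → Dec (u ≡ v)
_≟_ = ≡-dec _≟B_

allBits : (n : ℕ) → List (Bits n)
allBits zero = [] ∷ []
allBits (suc n) = L.map (true ∷_) (allBits n) L.++ L.map (false ∷_) (allBits n)

Dom : ℕ → Set
Dom m = Bits m × Bits m

allDom : (m : ℕ) → List (Dom m)
allDom m = cartesianProduct (allBits m) (allBits m)

_⊕D_ : ∀ {m} → Dom m → Dom m → Dom m
(x , y) ⊕D (x' , y') = (x ⊕ x') , (y ⊕ y')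

_·D_ : ∀ {m} → Bool → Dom m → Dom m
b ·D (x , y) = (b · x) , (b · y)

record IsLeftPreQuasifield (m : ℕ) (_⋆_ : Bits m → Bits m → Bits m) : Set where
  field
    zero-right : ∀ x → x ⋆ 𝟘 ≡ 𝟘
    zero-left  : ∀ x → 𝟘 ⋆ x ≡ 𝟘
    distrib-left : ∀ x y z → x ⋆ (y ⊕ z) ≡ (x ⋆ y) ⊕ (x ⋆ z)
    right-bij : ∀ a → a ≢ 𝟘 → Bijective _≡_ _≡_ (λ x → x ⋆ a)
    left-bij  : ∀ a → a ≢ 𝟘 → Bijective _≡_ _≡_ (λ x → a ⋆ x)

findFirst : ∀ {A : Set} {P : A → Set} → (∀ a → Dec (P a)) → A → List A → A
findFirst P? d [] = d
findFirst P? d (a ∷ as) with P? a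
... | yes _ = a
... | no _ = findFirst P? d as

-- right division  ⋆(x / y) : = a if y ≠ 0 and x = a ⋆ y ; = 0 if y = 0
rdiv : ∀ {m} → (Bits m → Bits m → Bits m) → Bits m → Bits m → Bits m
rdiv {m} _⋆_ x y with y ≟ 𝟘
... | yes _ = 𝟘
... | no _ = findFirst (λ a → (a ⋆ y) ≟ x) 𝟘 (allBits m)

-- g : F_2^m → F_2^t balanced : |g⁻¹(b)| = |A|/|B|, i.e. |g⁻¹(b)| * 2^t = 2^m
preimageSize : ∀ {m t} → (Bits m → Bits t) → Bits t → ℕ
preimageSize {m} g b = length (filter (λ a → g a ≟ b) (allBits m))

Balanced : ∀ {m t} → (Bits m → Bits t) → Set
Balanced {m} {t} g = ∀ b → preimageSize g b * 2 ^ t ≡ 2 ^ m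

Surjective : ∀ {m t} → (Bits m → Bits t) → Set
Surjective g = ∀ b → ∃ λ a → g a ≡ b

IsF2Linear : ∀ {m t} → (Bits m → Bits t) → Set
IsF2Linear g = (∀ x y → g (x ⊕ y) ≡ g x ⊕ g y) × (∀ c x → g (c · x) ≡ c · g x)

Invertible : ∀ {m} → (Bits m → Bits m) → Set
Invertible {m} s = Σ (Bits m → Bits m) λ s⁻¹ → (∀ x → s⁻¹ (s x) ≡ x) × (∀ x → s (s⁻¹ x) ≡ x)

IsLinearD : ∀ {m t} → (Dom m → Bits t) → Set
IsLinearD L = (∀ u v → L (u ⊕D v) ≡ L u ⊕ L v) × (∀ c u → L (c ·D u) ≡ c · L u)

IsAffine : ∀ {m t} → (Dom m → Bits t) → Set
IsAffine {m} {t} A = Σ (Dom m → Bits t) λ L → Σ (Bits t) λ c →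
  IsLinearD L × (∀ u → A u ≡ L u ⊕ c)

dH : ∀ {m t} → (Dom m → Bits t) → (Dom m → Bits t) → ℕ
dH {m} f g = length (filter (λ u → ¬? (f u ≟ g u)) (allDom m))

DistToAffine : ∀ {m t} → (Dom m → Bits t) → ℕ → Set
DistToAffine {m} {t} f D =
  (Σ (Dom m → Bits t) λ A → IsAffine A × dH f A ≡ D) ×
  (∀ (A : Dom m → Bits t) → IsAffine A → D ≤ dH f A)

-- (1 - 1/2^t)(2^{2m} - 2^m) = (2^t - 1) * 2^{m-t} * (2^m - 1)   (for t ≤ m)
targetValue : ℕ → ℕ → ℕ
targetValue m t = (2 ^ t ∸ 1) * 2 ^ (m ∸ t) * (2 ^ m ∸ 1)

f₁ : ∀ {m t} → (Bits m → Bits m → Bits m) → (Bits m → Bits t) → Dom m → Bits t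
f₁ _⋆_ γ (x , y) = γ (rdiv _⋆_ x y)

f₂ : ∀ {m t} → (Bits m → Bits m → Bits m) → (Bits m → Bits t) → (Bits m → Bits m)
   → (Bits m → Bits t) → Dom m → Bits t
f₂ _⋆_ τ σ h (x , y) = τ (σ y ⋆ x) ⊕ h y

{-# OPTIONS --safe #-}
-- Write q = 2^m, s = 2^t and r = 2^(m − t) = q/s. Since d_H(f, A) = q² − #{u | f u = A u}, both
-- claims say that an affine map agrees with f in at most q + (q − 1)r points and that a constant
-- map attains this.
--
-- For f₂ and A = L + c, fixing y makes x ↦ τ (σ y ⋆ x) + L (x, 0) additive, so column y agrees in
-- at most as many points as this map has zeros. Summing these kernels over b = σ y and exchanging
-- the sums, x = 0 contributes q and every other x contributes r, because b ↦ b ⋆ x is a bijection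
-- and τ is balanced.
--
-- For f₁, let N w count the u with f u + L u = w, so that L + c agrees with f in N c points. Every
-- derivative u ↦ f u + f (u + d) with d ≠ 0 is balanced: substituting x = a ⋆ y, a pair of slopes
-- a ≠ b is realised by exactly one y, since y ↦ a ⋆ y + b ⋆ y is injective. Hence Σ N = q² and
-- Σ N² = q² + (q² − 1)qr, and Cauchy–Schwarz over the s − 1 values w ≠ c bounds N c.
module Submission where

open import Defs
open import Data.Bool using (Bool; true; false; _∧_)
import Data.Bool.Properties as Bool
open import Data.Empty using (⊥-elim)
open import Data.List using (List; []; _∷_; _++_; map; length; filter; cartesianProduct)
import Data.List.Properties as List
open import Data.Nat using (ℕ; zero; suc; _+_; _*_; _^_; _∸_; _≤_; z≤n; s≤s; NonZero; _≤?_)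
open import Data.Nat.Properties hiding (_≟_)
open import Data.Nat.Properties using () renaming (_≟_ to _≟ℕ_)
open import Algebra.Properties.CommutativeSemigroup +-commutativeSemigroup
  using () renaming (interchange to +-interchange)
open import Data.Nat.Tactic.RingSolver using (solve-∀)
open import Data.Product using (_×_; _,_; ∃; proj₁; proj₂)
import Data.Product.Properties as Product
open import Data.Sum using (inj₁; inj₂)
open import Data.Vec using ([]; _∷_; replicate)
import Data.Vec.Properties as Vec
open import Function using (_∘_)
open import Function.Definitions using (Injective)
open import Relation.Binary.PropositionalEquality
open import Relation.Nullary using (Dec; yes; no; ¬_)
open import Relation.Nullary.Decidable using (¬?)

private
  variable
    A B : Set
    P Q R : Set

∑ : List A → (A → ℕ) → ℕ
∑ []       f = 0
∑ (x ∷ xs) f = f x + ∑ xs f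

infix 5 ∑
syntax ∑ xs (λ x → e) = ∑[ x ∈ xs ] e

𝟙[_] : Dec P → ℕ
𝟙[ yes _ ] = 1
𝟙[ no _ ]  = 0

𝟙-cong : (p : Dec P) (q : Dec Q) → (P → Q) → (Q → P) → 𝟙[ p ] ≡ 𝟙[ q ]
𝟙-cong (yes _) (yes _) _   _   = refl
𝟙-cong (yes p) (no ¬q) p→q _   = ⊥-elim (¬q (p→q p))
𝟙-cong (no ¬p) (yes q) _   q→p = ⊥-elim (¬p (q→p q))
𝟙-cong (no _)  (no _)  _   _   = refl

𝟙-yes : (p : Dec P) → P → 𝟙[ p ] ≡ 1
𝟙-yes (yes _) _ = refl
𝟙-yes (no ¬p) p = ⊥-elim (¬p p)

𝟙-no : (p : Dec P) → ¬ P → 𝟙[ p ] ≡ 0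
𝟙-no (yes p) ¬p = ⊥-elim (¬p p)
𝟙-no (no _)  _  = refl

𝟙≢0⇒ : (p : Dec P) → 𝟙[ p ] ≢ 0 → P
𝟙≢0⇒ (yes p) _   = p
𝟙≢0⇒ (no _)  1≢0 = ⊥-elim (1≢0 refl)

𝟙-× : (p : Dec P) (q : Dec Q) (r : Dec R) → (P → Q × R) → (Q → R → P) →
      𝟙[ p ] ≡ 𝟙[ q ] * 𝟙[ r ]
𝟙-× p (yes q) (yes r) _     pair = 𝟙-yes p (pair q r)
𝟙-× p (no ¬q) _       split _    = 𝟙-no p (¬q ∘ proj₁ ∘ split)
𝟙-× p (yes _) (no ¬r) split _    = 𝟙-no p (¬r ∘ proj₂ ∘ split)

𝟙[¬]+𝟙≡1 : (p : Dec P) → 𝟙[ ¬? p ] + 𝟙[ p ] ≡ 1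
𝟙[¬]+𝟙≡1 (yes _) = refl
𝟙[¬]+𝟙≡1 (no _)  = refl

∑-cong : (xs : List A) {f g : A → ℕ} → (∀ x → f x ≡ g x) → ∑ xs f ≡ ∑ xs g
∑-cong []       f≗g = refl
∑-cong (x ∷ xs) f≗g = cong₂ _+_ (f≗g x) (∑-cong xs f≗g)

∑-mono-≤ : (xs : List A) {f g : A → ℕ} → (∀ x → f x ≤ g x) → ∑ xs f ≤ ∑ xs g
∑-mono-≤ []       f≤g = z≤n
∑-mono-≤ (x ∷ xs) f≤g = +-mono-≤ (f≤g x) (∑-mono-≤ xs f≤g)

∑-distrib-+ : (xs : List A) (f g : A → ℕ) →
              (∑[ x ∈ xs ] f x + g x) ≡ ∑ xs f + ∑ xs g
∑-distrib-+ []       f g = refl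
∑-distrib-+ (x ∷ xs) f g = begin
  f x + g x + (∑[ x ∈ xs ] f x + g x) ≡⟨ cong (f x + g x +_) (∑-distrib-+ xs f g) ⟩
  f x + g x + (∑ xs f + ∑ xs g)      ≡⟨ +-interchange (f x) (g x) _ _ ⟩
  f x + ∑ xs f + (g x + ∑ xs g)      ∎
  where open ≡-Reasoning

∑-*ˡ : (xs : List A) (k : ℕ) (f : A → ℕ) → (∑[ x ∈ xs ] k * f x) ≡ k * ∑ xs f
∑-*ˡ []       k f = sym (*-zeroʳ k)
∑-*ˡ (x ∷ xs) k f = trans (cong (k * f x +_) (∑-*ˡ xs k f)) (sym (*-distribˡ-+ k (f x) _))

∑-*ʳ : (xs : List A) (k : ℕ) (f : A → ℕ) → (∑[ x ∈ xs ] f x * k) ≡ ∑ xs f * k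
∑-*ʳ xs k f = trans (∑-cong xs (λ x → *-comm (f x) k)) (trans (∑-*ˡ xs k f) (*-comm k _))

∑-const : (xs : List A) (k : ℕ) → (∑[ _ ∈ xs ] k) ≡ length xs * k
∑-const []       k = refl
∑-const (x ∷ xs) k = cong (k +_) (∑-const xs k)

∑-one : (xs : List A) → (∑[ _ ∈ xs ] 1) ≡ length xs
∑-one xs = trans (∑-const xs 1) (*-identityʳ (length xs))

∑-zero : (xs : List A) {f : A → ℕ} → (∀ x → f x ≡ 0) → ∑ xs f ≡ 0
∑-zero xs f≗0 = trans (∑-cong xs f≗0) (trans (∑-const xs 0) (*-zeroʳ (length xs)))

∑-++ : (xs ys : List A) (f : A → ℕ) → ∑ (xs ++ ys) f ≡ ∑ xs f + ∑ ys f
∑-++ []       ys f = refl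
∑-++ (x ∷ xs) ys f = trans (cong (f x +_) (∑-++ xs ys f)) (sym (+-assoc (f x) _ _))

∑≢0⇒∃ : (xs : List A) (f : A → ℕ) → ∑ xs f ≢ 0 → ∃ λ x → f x ≢ 0
∑≢0⇒∃ []       f ∑≢0 = ⊥-elim (∑≢0 refl)
∑≢0⇒∃ (x ∷ xs) f ∑≢0 with f x in fx
... | zero  = ∑≢0⇒∃ xs f ∑≢0
... | suc _ = x , λ fx≡0 → 0≢1+n (trans (sym fx≡0) fx)

∑𝟙-everywhere : {P : A → Set} (P? : ∀ x → Dec (P x)) (xs : List A) → (∀ x → P x) →
                (∑[ x ∈ xs ] 𝟙[ P? x ]) ≡ length xs
∑𝟙-everywhere P? xs holds = trans (∑-cong xs (λ x → 𝟙-yes (P? x) (holds x))) (∑-one xs)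

length-filter≡∑𝟙 : {P : A → Set} (P? : ∀ x → Dec (P x)) (xs : List A) →
                   length (filter P? xs) ≡ ∑[ x ∈ xs ] 𝟙[ P? x ]
length-filter≡∑𝟙 P? []       = refl
length-filter≡∑𝟙 P? (x ∷ xs) with P? x
... | yes _ = cong suc (length-filter≡∑𝟙 P? xs)
... | no _  = length-filter≡∑𝟙 P? xs

∑-map : (g : A → B) (xs : List A) (f : B → ℕ) → ∑ (map g xs) f ≡ ∑[ x ∈ xs ] f (g x)
∑-map g []       f = refl
∑-map g (x ∷ xs) f = cong (f (g x) +_) (∑-map g xs f)

∑-comm : (xs : List A) (ys : List B) (F : A → B → ℕ) →
         (∑[ x ∈ xs ] ∑[ y ∈ ys ] F x y) ≡ (∑[ y ∈ ys ] ∑[ x ∈ xs ] F x y)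
∑-comm []       ys F = sym (∑-zero ys (λ _ → refl))
∑-comm (x ∷ xs) ys F =
  trans (cong (∑ ys (F x) +_) (∑-comm xs ys F)) (sym (∑-distrib-+ ys (F x) _))

∑-cartesianProduct : (xs : List A) (ys : List B) (F : A × B → ℕ) →
                     ∑ (cartesianProduct xs ys) F ≡ (∑[ x ∈ xs ] ∑[ y ∈ ys ] F (x , y))
∑-cartesianProduct []       ys F = refl
∑-cartesianProduct (x ∷ xs) ys F = trans (∑-++ (map (x ,_) ys) _ F)
  (cong₂ _+_ (∑-map (x ,_) ys F) (∑-cartesianProduct xs ys F))

2xy≤x²+y² : ∀ x y → 2 * (x * y) ≤ x * x + y * y
2xy≤x²+y² x y with ≤-total x y
... | inj₁ x≤y = subst (λ y → 2 * (x * y) ≤ x * x + y * y) (m+[n∸m]≡n x≤y)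
                   (≤-trans (m≤m+n _ _) (≤-reflexive (square-gap x (y ∸ x))))
  where
  square-gap : ∀ x k → 2 * (x * (x + k)) + k * k ≡ x * x + (x + k) * (x + k)
  square-gap = solve-∀
... | inj₂ y≤x = subst (λ x → 2 * (x * y) ≤ x * x + y * y) (m+[n∸m]≡n y≤x)
                   (≤-trans (m≤m+n _ _) (≤-reflexive (square-gap y (x ∸ y))))
  where
  square-gap : ∀ y k → 2 * ((y + k) * y) + k * k ≡ (y + k) * (y + k) + y * y
  square-gap = solve-∀

private
  cross-terms : (xs : List A) (a x : A → ℕ) (x₀ : ℕ) →
    2 * (x₀ * (∑[ j ∈ xs ] a j * x j)) ≤ (∑[ j ∈ xs ] a j * (x j * x j)) + ∑ xs a * (x₀ * x₀)
  cross-terms xs a x x₀ = begin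
    2 * (x₀ * (∑[ j ∈ xs ] a j * x j))
      ≡⟨ *-assoc 2 x₀ _ ⟨
    2 * x₀ * (∑[ j ∈ xs ] a j * x j)
      ≡⟨ ∑-*ˡ xs (2 * x₀) _ ⟨
    (∑[ j ∈ xs ] 2 * x₀ * (a j * x j))
      ≡⟨ ∑-cong xs (λ j → reorder x₀ (a j) (x j)) ⟩
    (∑[ j ∈ xs ] a j * (2 * (x₀ * x j)))
      ≤⟨ ∑-mono-≤ xs (λ j → *-monoʳ-≤ (a j) (am-gm j)) ⟩
    (∑[ j ∈ xs ] a j * (x j * x j + x₀ * x₀))
      ≡⟨ ∑-cong xs (λ j → *-distribˡ-+ (a j) _ _) ⟩
    (∑[ j ∈ xs ] a j * (x j * x j) + a j * (x₀ * x₀))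
      ≡⟨ ∑-distrib-+ xs _ _ ⟩
    (∑[ j ∈ xs ] a j * (x j * x j)) + (∑[ j ∈ xs ] a j * (x₀ * x₀))
      ≡⟨ cong (_ +_) (∑-*ʳ xs (x₀ * x₀) a) ⟩
    (∑[ j ∈ xs ] a j * (x j * x j)) + ∑ xs a * (x₀ * x₀) ∎
    where
    open ≤-Reasoning
    reorder : ∀ x₀ a x → 2 * x₀ * (a * x) ≡ a * (2 * (x₀ * x))
    reorder = solve-∀
    am-gm : ∀ j → 2 * (x₀ * x j) ≤ x j * x j + x₀ * x₀
    am-gm j = ≤-trans (2xy≤x²+y² x₀ (x j)) (≤-reflexive (+-comm (x₀ * x₀) _))

cauchy-schwarz : (xs : List A) (a x : A → ℕ) →
  (∑[ j ∈ xs ] a j * x j) * (∑[ j ∈ xs ] a j * x j) ≤ ∑ xs a * (∑[ j ∈ xs ] a j * (x j * x j))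
cauchy-schwarz []       a x = z≤n
cauchy-schwarz (i ∷ is) a x = begin
  (aᵢ * xᵢ + S) * (aᵢ * xᵢ + S)
    ≡⟨ expand-left aᵢ xᵢ S ⟩
  aᵢ * aᵢ * (xᵢ * xᵢ) + aᵢ * (2 * (xᵢ * S)) + S * S
    ≤⟨ +-mono-≤ (+-monoʳ-≤ (aᵢ * aᵢ * (xᵢ * xᵢ)) (*-monoʳ-≤ aᵢ (cross-terms is a x xᵢ)))
                (cauchy-schwarz is a x) ⟩
  aᵢ * aᵢ * (xᵢ * xᵢ) + aᵢ * (V + W * (xᵢ * xᵢ)) + W * V
    ≡⟨ expand-right aᵢ xᵢ W V ⟨
  (aᵢ + W) * (aᵢ * (xᵢ * xᵢ) + V) ∎
  where
  open ≤-Reasoning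
  aᵢ xᵢ S W V : ℕ
  aᵢ = a i
  xᵢ = x i
  S = ∑[ j ∈ is ] a j * x j
  W = ∑ is a
  V = ∑[ j ∈ is ] a j * (x j * x j)
  expand-left : ∀ a x S → (a * x + S) * (a * x + S) ≡ a * a * (x * x) + a * (2 * (x * S)) + S * S
  expand-left = solve-∀
  expand-right : ∀ a x W V →
    (a + W) * (a * (x * x) + V) ≡ a * a * (x * x) + a * (V + W * (x * x)) + W * V
  expand-right = solve-∀

-- With X = qr + k, the moment equations give a V + (a + 1) k² = P² + (a + 1) (a r)², so P² ≤ a V
-- forces k ≤ a r. Adding Z to both sides makes every step a semiring identity.
private
  deviation-identity : ∀ a r k P V → let q = suc a * r; X = q * r + k in
    P + X ≡ q * q → V + X * X + q * r ≡ q * q + q * q * (q * r) →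
    a * V + suc a * (k * k) ≡ P * P + suc a * (a * r * (a * r))
  deviation-identity a r k P V P+X≡T V+X²+qr≡T+Tqr = +-cancelʳ-≡ Z _ _ (begin
    a * V + s * (k * k) + Z
      ≡⟨ collect-V a r k V ⟩
    a * (V + X * X + q * r) + s * (k * k) + 2 * (T * X)
      ≡⟨ cong (λ e → a * e + s * (k * k) + 2 * (T * X)) V+X²+qr≡T+Tqr ⟩
    a * (T + T * (q * r)) + s * (k * k) + 2 * (T * X)
      ≡⟨ key-polynomial a r k ⟩
    T * T + X * X + s * (E * E) + a * (X * X) + a * (q * r)
      ≡⟨ cong (λ e → e + s * (E * E) + a * (X * X) + a * (q * r)) P²+2TX≡T²+X² ⟨
    P * P + 2 * (T * X) + s * (E * E) + a * (X * X) + a * (q * r)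
      ≡⟨ collect-P a r k P ⟩
    P * P + s * (E * E) + Z ∎)
    where
    open ≡-Reasoning
    s q T X E Z : ℕ
    s = suc a
    q = s * r
    T = q * q
    X = q * r + k
    E = a * r
    Z = a * (X * X) + a * (q * r) + 2 * (T * X)
    P²+2TX≡T²+X² : P * P + 2 * (T * X) ≡ T * T + X * X
    P²+2TX≡T²+X² = subst (λ T → P * P + 2 * (T * X) ≡ T * T + X * X) P+X≡T (square P X)
      where
      square : ∀ P X → P * P + 2 * ((P + X) * X) ≡ (P + X) * (P + X) + X * X
      square = solve-∀
    collect-V : ∀ a r k V → let s = suc a; q = s * r; T = q * q; X = q * r + k in
      a * V + s * (k * k) + (a * (X * X) + a * (q * r) + 2 * (T * X))
        ≡ a * (V + X * X + q * r) + s * (k * k) + 2 * (T * X)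
    collect-V = solve-∀
    key-polynomial : ∀ a r k → let s = suc a; q = s * r; T = q * q; X = q * r + k; E = a * r in
      a * (T + T * (q * r)) + s * (k * k) + 2 * (T * X)
        ≡ T * T + X * X + s * (E * E) + a * (X * X) + a * (q * r)
    key-polynomial = solve-∀
    collect-P : ∀ a r k P → let s = suc a; q = s * r; T = q * q; X = q * r + k; E = a * r in
      P * P + 2 * (T * X) + s * (E * E) + a * (X * X) + a * (q * r)
        ≡ P * P + s * (E * E) + (a * (X * X) + a * (q * r) + 2 * (T * X))
    collect-P = solve-∀

second-moment-bound : ∀ a r q X P V → suc a * r ≡ q →
  P + X ≡ q * q → V + X * X + q * r ≡ q * q + q * q * (q * r) → P * P ≤ a * V →
  X + r ≤ q + q * r
second-moment-bound a r .(suc a * r) X P V refl P+X≡T V+X²+qr≡T+Tqr P²≤aV with X ≤? suc a * r * r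
... | yes X≤qr = begin
  X + r               ≤⟨ +-mono-≤ X≤qr (m≤m+n r (a * r)) ⟩
  q * r + q           ≡⟨ +-comm (q * r) q ⟩
  q + q * r           ∎
  where
  open ≤-Reasoning
  q : ℕ
  q = suc a * r
... | no X≰qr = begin
  X + r               ≡⟨ cong (_+ r) qr+k≡X ⟨
  q * r + k + r       ≤⟨ +-monoˡ-≤ r (+-monoʳ-≤ (q * r) k≤ar) ⟩
  q * r + a * r + r   ≡⟨ rearrange a r ⟩
  q + q * r           ∎
  where
  open ≤-Reasoning
  q k : ℕ
  q = suc a * r
  k = X ∸ q * r
  qr+k≡X : q * r + k ≡ X
  qr+k≡X = m+[n∸m]≡n (<⇒≤ (≰⇒> X≰qr))
  identity : a * V + suc a * (k * k) ≡ P * P + suc a * (a * r * (a * r))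
  identity = deviation-identity a r k P V
    (subst (λ X → P + X ≡ q * q) (sym qr+k≡X) P+X≡T)
    (subst (λ X → V + X * X + q * r ≡ q * q + q * q * (q * r)) (sym qr+k≡X) V+X²+qr≡T+Tqr)
  k²≤[ar]² : k * k ≤ a * r * (a * r)
  k²≤[ar]² = *-cancelˡ-≤ (suc a) (+-cancelˡ-≤ (a * V) _ _
    (≤-trans (≤-reflexive identity) (+-monoˡ-≤ _ P²≤aV)))
  k≤ar : k ≤ a * r
  k≤ar with k ≤? a * r
  ... | yes k≤ar = k≤ar
  ... | no k≰ar  = ⊥-elim (<⇒≱ (*-mono-< (≰⇒> k≰ar) (≰⇒> k≰ar)) k²≤[ar]²)
  rearrange : ∀ a r → let q = suc a * r in q * r + a * r + r ≡ q + q * r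
  rearrange = solve-∀

module Enumeration {A : Set} (xs : List A) (_≟A_ : (a b : A) → Dec (a ≡ b))
  (occurs-once : ∀ z → (∑[ x ∈ xs ] 𝟙[ x ≟A z ]) ≡ 1) where

  ∑-pick : ∀ z (F : A → ℕ) → (∑[ x ∈ xs ] 𝟙[ x ≟A z ] * F x) ≡ F z
  ∑-pick z F = begin
    (∑[ x ∈ xs ] 𝟙[ x ≟A z ] * F x) ≡⟨ ∑-cong xs at-z ⟩
    (∑[ x ∈ xs ] 𝟙[ x ≟A z ] * F z) ≡⟨ ∑-*ʳ xs (F z) _ ⟩
    (∑[ x ∈ xs ] 𝟙[ x ≟A z ]) * F z ≡⟨ cong (_* F z) (occurs-once z) ⟩
    F z + 0                          ≡⟨ +-identityʳ (F z) ⟩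
    F z                              ∎
    where
    open ≡-Reasoning
    at-z : ∀ x → 𝟙[ x ≟A z ] * F x ≡ 𝟙[ x ≟A z ] * F z
    at-z x with x ≟A z
    ... | yes refl = refl
    ... | no _     = refl

  ∑-pick′ : ∀ z (F : A → ℕ) → (∑[ x ∈ xs ] 𝟙[ z ≟A x ] * F x) ≡ F z
  ∑-pick′ z F = trans (∑-cong xs (λ x → cong (_* F x) (𝟙-cong (z ≟A x) (x ≟A z) sym sym))) (∑-pick z F)

  ∑-split : ∀ z (F G : A → ℕ) → (∀ x → x ≢ z → F x ≡ G x) → ∑ xs F + G z ≡ F z + ∑ xs G
  ∑-split z F G F≗G = begin
    ∑ xs F + G z                                           ≡⟨ cong (∑ xs F +_) (∑-pick z G) ⟨
    ∑ xs F + (∑[ x ∈ xs ] 𝟙[ x ≟A z ] * G x)               ≡⟨ ∑-distrib-+ xs F _ ⟨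
    (∑[ x ∈ xs ] F x + 𝟙[ x ≟A z ] * G x)                  ≡⟨ ∑-cong xs swap-at-z ⟩
    (∑[ x ∈ xs ] G x + 𝟙[ x ≟A z ] * F x)                  ≡⟨ ∑-distrib-+ xs G _ ⟩
    ∑ xs G + (∑[ x ∈ xs ] 𝟙[ x ≟A z ] * F x)               ≡⟨ cong (∑ xs G +_) (∑-pick z F) ⟩
    ∑ xs G + F z                                           ≡⟨ +-comm (∑ xs G) (F z) ⟩
    F z + ∑ xs G                                           ∎
    where
    open ≡-Reasoning
    swap-at-z : ∀ x → F x + 𝟙[ x ≟A z ] * G x ≡ G x + 𝟙[ x ≟A z ] * F x
    swap-at-z x with x ≟A z
    ... | yes refl = trans (cong (F x +_) (+-identityʳ (G x)))
                       (trans (+-comm (F x) (G x)) (cong (G x +_) (sym (+-identityʳ (F x)))))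
    ... | no x≢z   = cong (_+ 0) (F≗G x x≢z)

  ∑-const-except : ∀ z (F : A → ℕ) k → (∀ x → x ≢ z → F x ≡ k) → ∑ xs F + k ≡ F z + length xs * k
  ∑-const-except z F k F≗k = trans (∑-split z F (λ _ → k) F≗k) (cong (F z +_) (∑-const xs k))

  fibre : (A → A) → A → ℕ
  fibre φ z = ∑[ x ∈ xs ] 𝟙[ φ x ≟A z ]

  ∑-fibres : {B : Set} (ys : List B) (g : B → A) → (∑[ z ∈ xs ] ∑[ y ∈ ys ] 𝟙[ g y ≟A z ]) ≡ length ys
  ∑-fibres ys g = begin
    (∑[ z ∈ xs ] ∑[ y ∈ ys ] 𝟙[ g y ≟A z ])
      ≡⟨ ∑-comm xs ys (λ z y → 𝟙[ g y ≟A z ]) ⟩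
    (∑[ y ∈ ys ] ∑[ z ∈ xs ] 𝟙[ g y ≟A z ])
      ≡⟨ ∑-cong ys (λ y → ∑-cong xs (λ z → sym (*-identityʳ _))) ⟩
    (∑[ y ∈ ys ] ∑[ z ∈ xs ] 𝟙[ g y ≟A z ] * 1)
      ≡⟨ ∑-cong ys (λ y → ∑-pick′ (g y) (λ _ → 1)) ⟩
    (∑[ y ∈ ys ] 1)
      ≡⟨ ∑-one ys ⟩
    length ys ∎
    where open ≡-Reasoning

  fibre-≤1 : (φ : A → A) → Injective _≡_ _≡_ φ → ∀ z → fibre φ z ≤ 1
  fibre-≤1 φ φ-inj z with fibre φ z ≟ℕ 0
  ... | yes ≡0 = ≤-trans (≤-reflexive ≡0) z≤n
  ... | no ≢0 with ∑≢0⇒∃ xs _ ≢0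
  ... | x₀ , hit = ≤-trans (∑-mono-≤ xs only-x₀) (≤-reflexive (occurs-once x₀))
    where
    only-x₀ : ∀ x → 𝟙[ φ x ≟A z ] ≤ 𝟙[ x ≟A x₀ ]
    only-x₀ x with φ x ≟A z | x ≟A x₀
    ... | yes _   | yes _   = ≤-refl
    ... | no _    | _       = z≤n
    ... | yes φx≡z | no x≢x₀ = ⊥-elim (x≢x₀ (φ-inj (trans φx≡z (sym (𝟙≢0⇒ (φ x₀ ≟A z) hit)))))

  ≤1∧∑≡length⇒≡1 : (h : A → ℕ) → (∀ z → h z ≤ 1) → ∑ xs h ≡ length xs → ∀ z → h z ≡ 1
  ≤1∧∑≡length⇒≡1 h h≤1 ∑h≡len z with h z in hz | h≤1 z
  ... | suc zero | _             = refl
  ... | suc (suc _) | s≤s ()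
  ... | zero     | _             = ⊥-elim (1+n≰n (begin
    suc (length xs)                      ≡⟨ cong suc ∑h≡len ⟨
    suc (∑ xs h)                         ≡⟨ +-comm 1 (∑ xs h) ⟩
    ∑ xs h + 1                           ≡⟨ cong (∑ xs h +_) (occurs-once z) ⟨
    ∑ xs h + (∑[ x ∈ xs ] 𝟙[ x ≟A z ])   ≡⟨ ∑-distrib-+ xs h _ ⟨
    (∑[ x ∈ xs ] h x + 𝟙[ x ≟A z ])      ≤⟨ ∑-mono-≤ xs h+δ≤1 ⟩
    (∑[ _ ∈ xs ] 1)                      ≡⟨ ∑-one xs ⟩
    length xs                            ∎))
    where
    open ≤-Reasoning
    h+δ≤1 : ∀ x → h x + 𝟙[ x ≟A z ] ≤ 1
    h+δ≤1 x with x ≟A z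
    ... | yes refl = ≤-reflexive (cong (_+ 1) hz)
    ... | no _     = ≤-trans (≤-reflexive (+-identityʳ (h x))) (h≤1 x)

  fibre≡1 : (φ : A → A) → Injective _≡_ _≡_ φ → ∀ z → fibre φ z ≡ 1
  fibre≡1 φ φ-inj = ≤1∧∑≡length⇒≡1 (fibre φ) (fibre-≤1 φ φ-inj) (∑-fibres xs φ)

  ∑-reindex : (φ : A → A) → Injective _≡_ _≡_ φ → (F : A → ℕ) → (∑[ x ∈ xs ] F (φ x)) ≡ ∑ xs F
  ∑-reindex φ φ-inj F = begin
    (∑[ x ∈ xs ] F (φ x))
      ≡⟨ ∑-cong xs (λ x → ∑-pick′ (φ x) F) ⟨
    (∑[ x ∈ xs ] ∑[ z ∈ xs ] 𝟙[ φ x ≟A z ] * F z)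
      ≡⟨ ∑-comm xs xs _ ⟩
    (∑[ z ∈ xs ] ∑[ x ∈ xs ] 𝟙[ φ x ≟A z ] * F z)
      ≡⟨ ∑-cong xs (λ z → ∑-*ʳ xs (F z) _) ⟩
    (∑[ z ∈ xs ] fibre φ z * F z)
      ≡⟨ ∑-cong xs (λ z → cong (_* F z) (fibre≡1 φ φ-inj z)) ⟩
    (∑[ z ∈ xs ] F z + 0)
      ≡⟨ ∑-cong xs (λ z → +-identityʳ (F z)) ⟩
    ∑ xs F ∎
    where open ≡-Reasoning

⊕-assoc : ∀ {n} (a b c : Bits n) → (a ⊕ b) ⊕ c ≡ a ⊕ (b ⊕ c)
⊕-assoc = Vec.zipWith-assoc Bool.xor-assoc

⊕-comm : ∀ {n} (a b : Bits n) → a ⊕ b ≡ b ⊕ a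
⊕-comm = Vec.zipWith-comm Bool.xor-comm

⊕-identityˡ : ∀ {n} (a : Bits n) → 𝟘 ⊕ a ≡ a
⊕-identityˡ = Vec.zipWith-identityˡ Bool.xor-identityˡ

⊕-identityʳ : ∀ {n} (a : Bits n) → a ⊕ 𝟘 ≡ a
⊕-identityʳ = Vec.zipWith-identityʳ Bool.xor-identityʳ

⊕-self : ∀ {n} (a : Bits n) → a ⊕ a ≡ 𝟘
⊕-self a = trans (cong (_⊕ a) (sym (Vec.map-id a))) (Vec.zipWith-inverseˡ Bool.xor-same a)

⊕-interchange : ∀ {n} (a b c d : Bits n) → (a ⊕ b) ⊕ (c ⊕ d) ≡ (a ⊕ c) ⊕ (b ⊕ d)
⊕-interchange a b c d = begin
  (a ⊕ b) ⊕ (c ⊕ d) ≡⟨ ⊕-assoc a b (c ⊕ d) ⟩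
  a ⊕ (b ⊕ (c ⊕ d)) ≡⟨ cong (a ⊕_) (⊕-assoc b c d) ⟨
  a ⊕ ((b ⊕ c) ⊕ d) ≡⟨ cong (λ e → a ⊕ (e ⊕ d)) (⊕-comm b c) ⟩
  a ⊕ ((c ⊕ b) ⊕ d) ≡⟨ cong (a ⊕_) (⊕-assoc c b d) ⟩
  a ⊕ (c ⊕ (b ⊕ d)) ≡⟨ ⊕-assoc a c (b ⊕ d) ⟨
  (a ⊕ c) ⊕ (b ⊕ d) ∎
  where open ≡-Reasoning

⊕-moveʳ : ∀ {n} {a b c : Bits n} → a ⊕ b ≡ c → a ≡ c ⊕ b
⊕-moveʳ {a = a} {b} refl = sym (trans (⊕-assoc a b b) (trans (cong (a ⊕_) (⊕-self b)) (⊕-identityʳ a)))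

⊕-moveʳ⁻¹ : ∀ {n} {a b c : Bits n} → a ≡ c ⊕ b → a ⊕ b ≡ c
⊕-moveʳ⁻¹ e = sym (⊕-moveʳ (sym e))

⊕-cancelˡ : ∀ {n} {a b c : Bits n} → a ⊕ b ≡ a ⊕ c → b ≡ c
⊕-cancelˡ {a = a} {b} {c} e = begin
  b           ≡⟨ ⊕-moveʳ (trans (⊕-comm b a) e) ⟩
  (a ⊕ c) ⊕ a ≡⟨ ⊕-comm (a ⊕ c) a ⟩
  a ⊕ (a ⊕ c) ≡⟨ ⊕-assoc a a c ⟨
  (a ⊕ a) ⊕ c ≡⟨ cong (_⊕ c) (⊕-self a) ⟩
  𝟘 ⊕ c       ≡⟨ ⊕-identityˡ c ⟩
  c           ∎
  where open ≡-Reasoning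

⊕-cancelʳ : ∀ {n} {a b c : Bits n} → a ⊕ c ≡ b ⊕ c → a ≡ b
⊕-cancelʳ {a = a} {b} {c} e = ⊕-cancelˡ (trans (⊕-comm c a) (trans e (⊕-comm b c)))

⊕≡𝟘⇒≡ : ∀ {n} {a b : Bits n} → a ⊕ b ≡ 𝟘 → a ≡ b
⊕≡𝟘⇒≡ {b = b} e = trans (⊕-moveʳ e) (⊕-identityˡ b)

≡⇒⊕≡𝟘 : ∀ {n} {a b : Bits n} → a ≡ b → a ⊕ b ≡ 𝟘
≡⇒⊕≡𝟘 {a = a} refl = ⊕-self a

⊕-exchange : ∀ {n} {a b c d : Bits n} → a ⊕ b ≡ c ⊕ d → a ⊕ c ≡ b ⊕ d
⊕-exchange {a = a} {b} {c} {d} e =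
  ⊕≡𝟘⇒≡ (trans (sym (⊕-interchange a b c d)) (≡⇒⊕≡𝟘 e))

𝟙-⊕-move : ∀ {n} (a b c : Bits n) → 𝟙[ (a ⊕ b) ≟ c ] ≡ 𝟙[ a ≟ (c ⊕ b) ]
𝟙-⊕-move a b c = 𝟙-cong ((a ⊕ b) ≟ c) (a ≟ (c ⊕ b)) ⊕-moveʳ ⊕-moveʳ⁻¹

additive⇒𝟘↦𝟘 : ∀ {n k} (g : Bits n → Bits k) → (∀ x y → g (x ⊕ y) ≡ g x ⊕ g y) → g 𝟘 ≡ 𝟘
additive⇒𝟘↦𝟘 g additive =
  trans (cong g (sym (⊕-self 𝟘))) (trans (additive 𝟘 𝟘) (⊕-self (g 𝟘)))

allBits-once : ∀ n (z : Bits n) → (∑[ x ∈ allBits n ] 𝟙[ x ≟ z ]) ≡ 1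
allBits-once zero    []      = refl
allBits-once (suc n) (b ∷ z) = begin
  ∑ (map (true ∷_) xs ++ map (false ∷_) xs) δ
    ≡⟨ ∑-++ (map (true ∷_) xs) _ δ ⟩
  ∑ (map (true ∷_) xs) δ + ∑ (map (false ∷_) xs) δ
    ≡⟨ cong₂ _+_ (∑-map _ xs δ) (∑-map _ xs δ) ⟩
  (∑[ x ∈ xs ] δ (true ∷ x)) + (∑[ x ∈ xs ] δ (false ∷ x))
    ≡⟨ cong₂ _+_ (head-then-tail true) (head-then-tail false) ⟩
  𝟙[ true Bool.≟ b ] * 1 + 𝟙[ false Bool.≟ b ] * 1
    ≡⟨ one-head b ⟩
  1 ∎
  where
  open ≡-Reasoning
  xs : List (Bits n)
  xs = allBits n
  δ : Bits (suc n) → ℕ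
  δ x = 𝟙[ x ≟ (b ∷ z) ]
  head-then-tail : ∀ a → (∑[ x ∈ xs ] δ (a ∷ x)) ≡ 𝟙[ a Bool.≟ b ] * 1
  head-then-tail a = begin
    (∑[ x ∈ xs ] δ (a ∷ x))
      ≡⟨ ∑-cong xs (λ x → 𝟙-× _ (a Bool.≟ b) (x ≟ z) Vec.∷-injective (cong₂ _∷_)) ⟩
    (∑[ x ∈ xs ] 𝟙[ a Bool.≟ b ] * 𝟙[ x ≟ z ])
      ≡⟨ ∑-*ˡ xs 𝟙[ a Bool.≟ b ] _ ⟩
    𝟙[ a Bool.≟ b ] * (∑[ x ∈ xs ] 𝟙[ x ≟ z ])
      ≡⟨ cong (𝟙[ a Bool.≟ b ] *_) (allBits-once n z) ⟩
    𝟙[ a Bool.≟ b ] * 1 ∎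
  one-head : ∀ b → 𝟙[ true Bool.≟ b ] * 1 + 𝟙[ false Bool.≟ b ] * 1 ≡ 1
  one-head true  = refl
  one-head false = refl

length-allBits : ∀ n → length (allBits n) ≡ 2 ^ n
length-allBits zero    = refl
length-allBits (suc n) = begin
  length (map (true ∷_) xs ++ map (false ∷_) xs)
    ≡⟨ List.length-++ (map (true ∷_) xs) ⟩
  length (map (true ∷_) xs) + length (map (false ∷_) xs)
    ≡⟨ cong₂ _+_ (List.length-map _ xs) (List.length-map _ xs) ⟩
  length xs + length xs
    ≡⟨ cong₂ _+_ (length-allBits n) (trans (length-allBits n) (sym (+-identityʳ _))) ⟩
  2 ^ n + (2 ^ n + 0) ∎
  where
  open ≡-Reasoning
  xs : List (Bits n)
  xs = allBits n

_≟D_ : ∀ {m} (u v : Dom m) → Dec (u ≡ v)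
_≟D_ = Product.≡-dec _≟_ _≟_

∑-allDom : ∀ m (F : Dom m → ℕ) → ∑ (allDom m) F ≡ (∑[ x ∈ allBits m ] ∑[ y ∈ allBits m ] F (x , y))
∑-allDom m = ∑-cartesianProduct (allBits m) (allBits m)

allDom-once : ∀ m (z : Dom m) → (∑[ u ∈ allDom m ] 𝟙[ u ≟D z ]) ≡ 1
allDom-once m (z₁ , z₂) = begin
  (∑[ u ∈ allDom m ] 𝟙[ u ≟D (z₁ , z₂) ])
    ≡⟨ ∑-allDom m _ ⟩
  (∑[ x ∈ xs ] ∑[ y ∈ xs ] 𝟙[ (x , y) ≟D (z₁ , z₂) ])
    ≡⟨ ∑-cong xs (λ x → ∑-cong xs (λ y →
         𝟙-× _ (x ≟ z₁) (y ≟ z₂) Product.,-injective (cong₂ _,_))) ⟩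
  (∑[ x ∈ xs ] ∑[ y ∈ xs ] 𝟙[ x ≟ z₁ ] * 𝟙[ y ≟ z₂ ])
    ≡⟨ ∑-cong xs (λ x → ∑-*ˡ xs 𝟙[ x ≟ z₁ ] _) ⟩
  (∑[ x ∈ xs ] 𝟙[ x ≟ z₁ ] * (∑[ y ∈ xs ] 𝟙[ y ≟ z₂ ]))
    ≡⟨ ∑-cong xs (λ x → cong (𝟙[ x ≟ z₁ ] *_) (allBits-once m z₂)) ⟩
  (∑[ x ∈ xs ] 𝟙[ x ≟ z₁ ] * 1)
    ≡⟨ ∑-cong xs (λ x → *-identityʳ _) ⟩
  (∑[ x ∈ xs ] 𝟙[ x ≟ z₁ ])
    ≡⟨ allBits-once m z₁ ⟩
  1 ∎
  where
  open ≡-Reasoning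
  xs : List (Bits m)
  xs = allBits m

⊕D-cancelˡ : ∀ {m} (u : Dom m) {d d′ : Dom m} → u ⊕D d ≡ u ⊕D d′ → d ≡ d′
⊕D-cancelˡ (x , y) {_ , _} {_ , _} e =
  cong₂ _,_ (⊕-cancelˡ (Product.,-injectiveˡ e)) (⊕-cancelˡ (Product.,-injectiveʳ e))

⊕D-identityʳ : ∀ {m} (u : Dom m) → u ⊕D (𝟘 , 𝟘) ≡ u
⊕D-identityʳ (x , y) = cong₂ _,_ (⊕-identityʳ x) (⊕-identityʳ y)

module Bitsₑ (n : ℕ) = Enumeration (allBits n) _≟_ (allBits-once n)
module Domₑ (m : ℕ) = Enumeration (allDom m) _≟D_ (allDom-once m)

length-allDom : ∀ m → length (allDom m) ≡ 2 ^ m * 2 ^ m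
length-allDom m = begin
  length (allDom m)
    ≡⟨ ∑-one (allDom m) ⟨
  (∑[ _ ∈ allDom m ] 1)
    ≡⟨ ∑-allDom m _ ⟩
  (∑[ _ ∈ allBits m ] ∑[ _ ∈ allBits m ] 1)
    ≡⟨ ∑-cong (allBits m) (λ _ → ∑-one (allBits m)) ⟩
  (∑[ _ ∈ allBits m ] length (allBits m))
    ≡⟨ ∑-const (allBits m) _ ⟩
  length (allBits m) * length (allBits m)
    ≡⟨ cong₂ _*_ (length-allBits m) (length-allBits m) ⟩
  2 ^ m * 2 ^ m ∎
  where open ≡-Reasoning

#preimage : ∀ {n k} → (Bits n → Bits k) → Bits k → ℕ
#preimage {n} g w = ∑[ z ∈ allBits n ] 𝟙[ g z ≟ w ]

preimageSize≡#preimage : ∀ {n k} (g : Bits n → Bits k) w → preimageSize g w ≡ #preimage g w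
preimageSize≡#preimage {n} g w = length-filter≡∑𝟙 (λ z → g z ≟ w) (allBits n)

∑-#preimage : ∀ {n k} (g : Bits n → Bits k) → (∑[ w ∈ allBits k ] #preimage g w) ≡ 2 ^ n
∑-#preimage {n} {k} g = trans (Bitsₑ.∑-fibres k (allBits n) g) (length-allBits n)

balanced⇒#preimage : ∀ {m t} → t ≤ m → (g : Bits m → Bits t) → Balanced g →
                     ∀ w → #preimage g w ≡ 2 ^ (m ∸ t)
balanced⇒#preimage {m} {t} t≤m g balanced w = *-cancelʳ-≡ _ _ (2 ^ t) {{m^n≢0 2 t}} (begin
  #preimage g w * 2 ^ t     ≡⟨ cong (_* 2 ^ t) (preimageSize≡#preimage g w) ⟨
  preimageSize g w * 2 ^ t  ≡⟨ balanced w ⟩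
  2 ^ m                     ≡⟨ cong (2 ^_) (m∸n+n≡m t≤m) ⟨
  2 ^ (m ∸ t + t)           ≡⟨ ^-distribˡ-+-* 2 (m ∸ t) t ⟩
  2 ^ (m ∸ t) * 2 ^ t       ∎)
  where open ≡-Reasoning

module AdditiveMap {n k} (M : Bits n → Bits k) (additive : ∀ x y → M (x ⊕ y) ≡ M x ⊕ M y) where

  #preimage-image≡#kernel : ∀ z₀ → #preimage M (M z₀) ≡ #preimage M 𝟘
  #preimage-image≡#kernel z₀ = begin
    (∑[ z ∈ allBits n ] 𝟙[ M z ≟ M z₀ ])
      ≡⟨ Bitsₑ.∑-reindex n (_⊕ z₀) ⊕-cancelʳ _ ⟨
    (∑[ z ∈ allBits n ] 𝟙[ M (z ⊕ z₀) ≟ M z₀ ])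
      ≡⟨ ∑-cong (allBits n) (λ z → 𝟙-cong _ _ (to z) (from z)) ⟩
    (∑[ z ∈ allBits n ] 𝟙[ M z ≟ 𝟘 ]) ∎
    where
    open ≡-Reasoning
    to : ∀ z → M (z ⊕ z₀) ≡ M z₀ → M z ≡ 𝟘
    to z e = ⊕-cancelʳ (trans (sym (additive z z₀)) (trans e (sym (⊕-identityˡ (M z₀)))))
    from : ∀ z → M z ≡ 𝟘 → M (z ⊕ z₀) ≡ M z₀
    from z e = trans (additive z z₀) (trans (cong (_⊕ M z₀) e) (⊕-identityˡ (M z₀)))

  #preimage≤#kernel : ∀ w → #preimage M w ≤ #preimage M 𝟘
  #preimage≤#kernel w with #preimage M w ≟ℕ 0
  ... | yes ≡0 = ≤-trans (≤-reflexive ≡0) z≤n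
  ... | no ≢0 with ∑≢0⇒∃ (allBits n) _ ≢0
  ... | z₀ , hit rewrite sym (𝟙≢0⇒ (M z₀ ≟ w) hit) = ≤-reflexive (#preimage-image≡#kernel z₀)

  surjective⇒balanced : Surjective M → Balanced M
  surjective⇒balanced surjective w = begin
    preimageSize M w * 2 ^ k                  ≡⟨ cong (_* 2 ^ k) (preimageSize≡#preimage M w) ⟩
    #preimage M w * 2 ^ k                     ≡⟨ cong (_* 2 ^ k) (#preimage≡#kernel w) ⟩
    #kernel * 2 ^ k                           ≡⟨ cong (#kernel *_) (length-allBits k) ⟨
    #kernel * length (allBits k)              ≡⟨ *-comm #kernel _ ⟩
    length (allBits k) * #kernel              ≡⟨ ∑-const (allBits k) #kernel ⟨
    (∑[ v ∈ allBits k ] #kernel)              ≡⟨ ∑-cong (allBits k) #preimage≡#kernel ⟨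
    (∑[ v ∈ allBits k ] #preimage M v)        ≡⟨ ∑-#preimage M ⟩
    2 ^ n                                     ∎
    where
    open ≡-Reasoning
    #kernel : ℕ
    #kernel = #preimage M 𝟘
    #preimage≡#kernel : ∀ v → #preimage M v ≡ #kernel
    #preimage≡#kernel v with surjective v
    ... | z₀ , refl = #preimage-image≡#kernel z₀

findFirst-satisfies : {A : Set} {P : A → Set} (P? : ∀ a → Dec (P a)) (d : A) (xs : List A) →
                      (∑[ a ∈ xs ] 𝟙[ P? a ]) ≢ 0 → P (findFirst P? d xs)
findFirst-satisfies P? d []       none = ⊥-elim (none refl)
findFirst-satisfies P? d (a ∷ as) some with P? a
... | yes Pa = Pa
... | no _   = findFirst-satisfies P? d as some

module LeftPreQuasifield {m : ℕ} {_⋆_ : Bits m → Bits m → Bits m} (Q : IsLeftPreQuasifield m _⋆_) where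
  open IsLeftPreQuasifield Q public
  open Bitsₑ m using (fibre≡1)

  _÷_ : Bits m → Bits m → Bits m
  x ÷ y = rdiv _⋆_ x y

  ⋆-cancelʳ : ∀ y → y ≢ 𝟘 → Injective _≡_ _≡_ (_⋆ y)
  ⋆-cancelʳ y y≢𝟘 = proj₁ (right-bij y y≢𝟘)

  ⋆-cancelˡ : ∀ a → a ≢ 𝟘 → Injective _≡_ _≡_ (a ⋆_)
  ⋆-cancelˡ a a≢𝟘 = proj₁ (left-bij a a≢𝟘)

  ÷-by-𝟘 : ∀ x {y} → y ≡ 𝟘 → x ÷ y ≡ 𝟘
  ÷-by-𝟘 x {y} y≡𝟘 with y ≟ 𝟘
  ... | yes _   = refl
  ... | no y≢𝟘  = ⊥-elim (y≢𝟘 y≡𝟘)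

  ÷-⋆ : ∀ x {y} → y ≢ 𝟘 → (x ÷ y) ⋆ y ≡ x
  ÷-⋆ x {y} y≢𝟘 with y ≟ 𝟘
  ... | yes y≡𝟘 = ⊥-elim (y≢𝟘 y≡𝟘)
  ... | no _    = findFirst-satisfies (λ a → (a ⋆ y) ≟ x) 𝟘 (allBits m)
                    (λ ≡0 → 0≢1+n (trans (sym ≡0) (fibre≡1 (_⋆ y) (⋆-cancelʳ y y≢𝟘) x)))

  ⋆≡⇒≡÷ : ∀ {a x y} → y ≢ 𝟘 → a ⋆ y ≡ x → a ≡ x ÷ y
  ⋆≡⇒≡÷ {x = x} {y} y≢𝟘 a⋆y≡x = ⋆-cancelʳ y y≢𝟘 (trans a⋆y≡x (sym (÷-⋆ x y≢𝟘)))

  ≡÷⇒⋆≡ : ∀ {a x y} → y ≢ 𝟘 → a ≡ x ÷ y → a ⋆ y ≡ x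
  ≡÷⇒⋆≡ {x = x} y≢𝟘 refl = ÷-⋆ x y≢𝟘

  ⋆-÷ : ∀ a {y} → y ≢ 𝟘 → (a ⋆ y) ÷ y ≡ a
  ⋆-÷ a y≢𝟘 = sym (⋆≡⇒≡÷ y≢𝟘 refl)

  ÷-injective : ∀ {y} → y ≢ 𝟘 → Injective _≡_ _≡_ (_÷ y)
  ÷-injective {y} y≢𝟘 {x} {x′} e = begin
    x            ≡⟨ ÷-⋆ x y≢𝟘 ⟨
    (x ÷ y) ⋆ y  ≡⟨ cong (_⋆ y) e ⟩
    (x′ ÷ y) ⋆ y ≡⟨ ÷-⋆ x′ y≢𝟘 ⟩
    x′           ∎
    where open ≡-Reasoning

  ⋆-difference-injective : ∀ {a b} → a ≢ b → Injective _≡_ _≡_ (λ y → (a ⋆ y) ⊕ (b ⋆ y))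
  ⋆-difference-injective {a} {b} a≢b {y} {y′} e with (y ⊕ y′) ≟ 𝟘
  ... | yes y⊕y′≡𝟘 = ⊕≡𝟘⇒≡ y⊕y′≡𝟘
  ... | no y⊕y′≢𝟘  = ⊥-elim (a≢b (⋆-cancelʳ (y ⊕ y′) y⊕y′≢𝟘 (begin
    a ⋆ (y ⊕ y′)         ≡⟨ distrib-left a y y′ ⟩
    (a ⋆ y) ⊕ (a ⋆ y′)   ≡⟨ ⊕-exchange e ⟩
    (b ⋆ y) ⊕ (b ⋆ y′)   ≡⟨ distrib-left b y y′ ⟨
    b ⋆ (y ⊕ y′)         ∎)))
    where open ≡-Reasoning

agreements : ∀ {m t} → (Dom m → Bits t) → (Dom m → Bits t) → ℕ
agreements {m} f g = ∑[ u ∈ allDom m ] 𝟙[ f u ≟ g u ]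

∑-allDom-by-columns : ∀ m (F : Dom m → ℕ) →
  ∑ (allDom m) F ≡ (∑[ y ∈ allBits m ] ∑[ x ∈ allBits m ] F (x , y))
∑-allDom-by-columns m F = trans (∑-allDom m F) (∑-comm (allBits m) (allBits m) (λ x y → F (x , y)))

dH+agreements : ∀ {m t} (f g : Dom m → Bits t) → dH f g + agreements f g ≡ 2 ^ m * 2 ^ m
dH+agreements {m} f g = begin
  dH f g + agreements f g
    ≡⟨ cong (_+ agreements f g) (length-filter≡∑𝟙 _ (allDom m)) ⟩
  (∑[ u ∈ allDom m ] 𝟙[ ¬? (f u ≟ g u) ]) + agreements f g
    ≡⟨ ∑-distrib-+ (allDom m) _ _ ⟨
  (∑[ u ∈ allDom m ] 𝟙[ ¬? (f u ≟ g u) ] + 𝟙[ f u ≟ g u ])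
    ≡⟨ ∑-cong (allDom m) (λ u → 𝟙[¬]+𝟙≡1 (f u ≟ g u)) ⟩
  (∑[ u ∈ allDom m ] 1)
    ≡⟨ ∑-one (allDom m) ⟩
  length (allDom m)
    ≡⟨ length-allDom m ⟩
  2 ^ m * 2 ^ m ∎
  where open ≡-Reasoning

·-𝟘 : ∀ {n} (b : Bool) → b · 𝟘 {n} ≡ 𝟘
·-𝟘 {n} b = trans (Vec.map-replicate (b ∧_) false n) (cong (replicate n) (Bool.∧-zeroʳ b))

const-isAffine : ∀ {m t} (c : Bits t) → IsAffine {m} (λ _ → c)
const-isAffine c =
  (λ _ → 𝟘) , c , ((λ _ _ → sym (⊕-self 𝟘)) , (λ b _ → sym (·-𝟘 b))) , (λ _ → sym (⊕-identityˡ c))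

-- The maximal number of agreements is q + (q − 1) r = q² − targetValue m t; bounds on agreements
-- carry an extra r on both sides to avoid truncated subtraction.
module Sizes (m t : ℕ) (t≤m : t ≤ m) where

  q s r : ℕ
  q = 2 ^ m
  s = 2 ^ t
  r = 2 ^ (m ∸ t)

  s*r≡q : s * r ≡ q
  s*r≡q = trans (sym (^-distribˡ-+-* 2 t (m ∸ t))) (cong (2 ^_) (m+[n∸m]≡n t≤m))

  target+maxAgreements : targetValue m t + (q + q * r) ≡ q * q + r
  target+maxAgreements =
    arithmetic (s ∸ 1) (q ∸ 1) r q (sym (m+[n∸m]≡n (m^n>0 2 m)))
      (trans (cong (_* r) (m+[n∸m]≡n (m^n>0 2 t))) s*r≡q)
    where
    arithmetic : ∀ s′ q′ r q → q ≡ suc q′ → r + s′ * r ≡ q →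
                 s′ * r * q′ + (q + q * r) ≡ q * q + r
    arithmetic s′ q′ r .(suc q′) refl r+s′r≡q = +-cancelʳ-≡ (q′ * suc q′) _ _ (begin
      s′ * r * q′ + (suc q′ + suc q′ * r) + q′ * suc q′
        ≡⟨ polynomial s′ q′ r ⟩
      suc q′ * suc q′ + r + q′ * (r + s′ * r)
        ≡⟨ cong (λ e → suc q′ * suc q′ + r + q′ * e) r+s′r≡q ⟩
      suc q′ * suc q′ + r + q′ * suc q′ ∎)
      where
      open ≡-Reasoning
      polynomial : ∀ s′ q′ r → s′ * r * q′ + (suc q′ + suc q′ * r) + q′ * suc q′
                               ≡ suc q′ * suc q′ + r + q′ * (r + s′ * r)
      polynomial = solve-∀

  module _ {f A : Dom m → Bits t} where

    agreements-bound⇒target≤dH : agreements f A + r ≤ q + q * r → targetValue m t ≤ dH f A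
    agreements-bound⇒target≤dH bound = +-cancelʳ-≤ (agreements f A + r) _ _ (begin
      targetValue m t + (agreements f A + r)  ≤⟨ +-monoʳ-≤ (targetValue m t) bound ⟩
      targetValue m t + (q + q * r)           ≡⟨ target+maxAgreements ⟩
      q * q + r                               ≡⟨ cong (_+ r) (dH+agreements f A) ⟨
      dH f A + agreements f A + r             ≡⟨ +-assoc (dH f A) _ r ⟩
      dH f A + (agreements f A + r)           ∎)
      where open ≤-Reasoning

    agreements-max⇒dH≡target : agreements f A + r ≡ q + q * r → dH f A ≡ targetValue m t
    agreements-max⇒dH≡target max = +-cancelʳ-≡ (agreements f A + r) _ _ (begin
      dH f A + (agreements f A + r)           ≡⟨ +-assoc (dH f A) _ r ⟨
      dH f A + agreements f A + r             ≡⟨ cong (_+ r) (dH+agreements f A) ⟩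
      q * q + r                               ≡⟨ target+maxAgreements ⟨
      targetValue m t + (q + q * r)           ≡⟨ cong (targetValue m t +_) max ⟨
      targetValue m t + (agreements f A + r)  ∎)
      where open ≡-Reasoning

  distToAffine-fromAgreements : (f A₀ : Dom m → Bits t) → IsAffine A₀ →
    agreements f A₀ + r ≡ q + q * r →
    (∀ A → IsAffine A → agreements f A + r ≤ q + q * r) →
    DistToAffine f (targetValue m t)
  distToAffine-fromAgreements f A₀ A₀-affine attained bound =
    (A₀ , A₀-affine , agreements-max⇒dH≡target attained) ,
    (λ A A-affine → agreements-bound⇒target≤dH (bound A A-affine))

module F₁ (m t : ℕ) (t≤m : t ≤ m)
  {_⋆_ : Bits m → Bits m → Bits m} (Q : IsLeftPreQuasifield m _⋆_)
  (γ : Bits m → Bits t) (γ-balanced : Balanced γ) where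

  open Sizes m t t≤m
  open LeftPreQuasifield Q
  open Bitsₑ m using (∑-reindex; ∑-pick; ∑-split; ∑-const-except; fibre≡1)

  f : Dom m → Bits t
  f = f₁ _⋆_ γ

  xs : List (Bits m)
  xs = allBits m

  #γ⁻¹ : ∀ w → #preimage γ w ≡ r
  #γ⁻¹ = balanced⇒#preimage t≤m γ γ-balanced

  agreements-const : agreements f (λ _ → γ 𝟘) + r ≡ q + q * r
  agreements-const = begin
    agreements f (λ _ → γ 𝟘) + r  ≡⟨ cong (_+ r) (∑-allDom-by-columns m _) ⟩
    ∑ xs column + r              ≡⟨ ∑-const-except 𝟘 column r column-r ⟩
    column 𝟘 + length xs * r     ≡⟨ cong₂ (λ a b → a + b * r) column-𝟘 (length-allBits m) ⟩
    q + q * r                    ∎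
    where
    open ≡-Reasoning
    column : Bits m → ℕ
    column y = ∑[ x ∈ xs ] 𝟙[ γ (x ÷ y) ≟ γ 𝟘 ]
    column-r : ∀ y → y ≢ 𝟘 → column y ≡ r
    column-r y y≢𝟘 = trans (∑-reindex (_÷ y) (÷-injective y≢𝟘) (λ a → 𝟙[ γ a ≟ γ 𝟘 ])) (#γ⁻¹ (γ 𝟘))
    column-𝟘 : column 𝟘 ≡ q
    column-𝟘 = trans (∑𝟙-everywhere _ xs (λ x → cong γ (÷-by-𝟘 x refl))) (length-allBits m)

  #⋆-solutions : ∀ {y} → y ≢ 𝟘 → ∀ z → (∑[ b ∈ xs ] 𝟙[ (b ⋆ y) ≟ z ]) ≡ 1
  #⋆-solutions {y} y≢𝟘 = fibre≡1 (_⋆ y) (⋆-cancelʳ y y≢𝟘)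

  module Derivative (d₁ d₂ : Bits m) (w : Bits t) where
    open ≡-Reasoning

    g : Bits m → Bits m → ℕ
    g a b = 𝟙[ (γ a ⊕ γ b) ≟ w ]

    δ : ℕ
    δ = 𝟙[ 𝟘 ≟ w ]

    ∑ᵃ-g : ∀ b → (∑[ a ∈ xs ] g a b) ≡ r
    ∑ᵃ-g b = trans (∑-cong xs (λ a → 𝟙-⊕-move (γ a) (γ b) w)) (#γ⁻¹ (w ⊕ γ b))

    ∑ᵇ-g : ∀ a → ∑ xs (g a) ≡ r
    ∑ᵇ-g a = trans (∑-cong xs (λ b → trans (cong (λ v → 𝟙[ v ≟ w ]) (⊕-comm (γ a) (γ b)))
                                             (𝟙-⊕-move (γ b) (γ a) w)))
                   (#γ⁻¹ (w ⊕ γ a))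

    g-diagonal : ∀ a → g a a ≡ δ
    g-diagonal a = cong (λ v → 𝟙[ v ≟ w ]) (⊕-self (γ a))

    column : Bits m → ℕ
    column y = ∑[ x ∈ xs ] g (x ÷ y) ((x ⊕ d₁) ÷ (y ⊕ d₂))

    incidence : Bits m → Bits m → Bits m → ℕ
    incidence y a b = 𝟙[ (b ⋆ (y ⊕ d₂)) ≟ ((a ⋆ y) ⊕ d₁) ]

    column′ : Bits m → ℕ
    column′ y = ∑[ a ∈ xs ] ∑[ b ∈ xs ] incidence y a b * g a b

    column≡column′ : ∀ {y} → y ≢ 𝟘 → y ⊕ d₂ ≢ 𝟘 → column y ≡ column′ y
    column≡column′ {y} y≢𝟘 y⊕d₂≢𝟘 = begin
      column y
        ≡⟨ ∑-reindex (_⋆ y) (⋆-cancelʳ y y≢𝟘) _ ⟨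
      (∑[ a ∈ xs ] g ((a ⋆ y) ÷ y) (partner a))
        ≡⟨ ∑-cong xs (λ a → cong (λ a′ → g a′ (partner a)) (⋆-÷ a y≢𝟘)) ⟩
      (∑[ a ∈ xs ] g a (partner a))
        ≡⟨ ∑-cong xs (λ a → ∑-pick (partner a) (g a)) ⟨
      (∑[ a ∈ xs ] ∑[ b ∈ xs ] 𝟙[ b ≟ partner a ] * g a b)
        ≡⟨ ∑-cong xs (λ a → ∑-cong xs (λ b → cong (_* g a b)
             (𝟙-cong (b ≟ partner a) ((b ⋆ (y ⊕ d₂)) ≟ ((a ⋆ y) ⊕ d₁))
                     (≡÷⇒⋆≡ y⊕d₂≢𝟘) (⋆≡⇒≡÷ y⊕d₂≢𝟘)))) ⟩
      column′ y ∎
      where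
      partner : Bits m → Bits m
      partner a = ((a ⋆ y) ⊕ d₁) ÷ (y ⊕ d₂)

    multiplicity : Bits m → Bits m → ℕ
    multiplicity a b = ∑[ y ∈ xs ] incidence y a b

    multiplicity-offdiagonal : ∀ {a b} → b ≢ a → multiplicity a b ≡ 1
    multiplicity-offdiagonal {a} {b} b≢a = begin
      multiplicity a b
        ≡⟨ ∑-cong xs (λ y → 𝟙-cong _ _ to (from y)) ⟩
      (∑[ y ∈ xs ] 𝟙[ ((b ⋆ y) ⊕ (a ⋆ y)) ≟ ((b ⋆ d₂) ⊕ d₁) ])
        ≡⟨ fibre≡1 _ (⋆-difference-injective b≢a) _ ⟩
      1 ∎
      where
      to : ∀ {y} → b ⋆ (y ⊕ d₂) ≡ (a ⋆ y) ⊕ d₁ → (b ⋆ y) ⊕ (a ⋆ y) ≡ (b ⋆ d₂) ⊕ d₁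
      to {y} e = ⊕-exchange (trans (sym (distrib-left b y d₂)) e)
      from : ∀ y → (b ⋆ y) ⊕ (a ⋆ y) ≡ (b ⋆ d₂) ⊕ d₁ → b ⋆ (y ⊕ d₂) ≡ (a ⋆ y) ⊕ d₁
      from y e = trans (distrib-left b y d₂) (⊕-exchange e)

    multiplicity-diagonal : ∀ a → multiplicity a a ≡ q * 𝟙[ (a ⋆ d₂) ≟ d₁ ]
    multiplicity-diagonal a = begin
      multiplicity a a                       ≡⟨ ∑-cong xs (λ y → 𝟙-cong _ _ (to y) (from y)) ⟩
      (∑[ _ ∈ xs ] 𝟙[ (a ⋆ d₂) ≟ d₁ ])       ≡⟨ ∑-const xs _ ⟩
      length xs * 𝟙[ (a ⋆ d₂) ≟ d₁ ]         ≡⟨ cong (_* 𝟙[ (a ⋆ d₂) ≟ d₁ ]) (length-allBits m) ⟩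
      q * 𝟙[ (a ⋆ d₂) ≟ d₁ ]                 ∎
      where
      to : ∀ y → a ⋆ (y ⊕ d₂) ≡ (a ⋆ y) ⊕ d₁ → a ⋆ d₂ ≡ d₁
      to y e = ⊕-cancelˡ (trans (sym (distrib-left a y d₂)) e)
      from : ∀ y → a ⋆ d₂ ≡ d₁ → a ⋆ (y ⊕ d₂) ≡ (a ⋆ y) ⊕ d₁
      from y e = trans (distrib-left a y d₂) (cong ((a ⋆ y) ⊕_) e)

    #solutions : ℕ
    #solutions = ∑[ a ∈ xs ] 𝟙[ (a ⋆ d₂) ≟ d₁ ]

    ∑column′ : ∑ xs column′ + q * δ ≡ #solutions * (q * δ) + q * r
    ∑column′ = begin
      ∑ xs column′ + q * δ
        ≡⟨ cong₂ _+_ by-multiplicity qδ≡∑δ ⟩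
      (∑[ a ∈ xs ] ∑[ b ∈ xs ] multiplicity a b * g a b) + (∑[ _ ∈ xs ] δ)
        ≡⟨ ∑-distrib-+ xs _ _ ⟨
      (∑[ a ∈ xs ] (∑[ b ∈ xs ] multiplicity a b * g a b) + δ)
        ≡⟨ ∑-cong xs row ⟩
      (∑[ a ∈ xs ] 𝟙[ (a ⋆ d₂) ≟ d₁ ] * (q * δ) + r)
        ≡⟨ ∑-distrib-+ xs _ _ ⟩
      (∑[ a ∈ xs ] 𝟙[ (a ⋆ d₂) ≟ d₁ ] * (q * δ)) + (∑[ _ ∈ xs ] r)
        ≡⟨ cong₂ _+_ (∑-*ʳ xs (q * δ) _) (∑-const xs r) ⟩
      #solutions * (q * δ) + length xs * r
        ≡⟨ cong (λ n → #solutions * (q * δ) + n * r) (length-allBits m) ⟩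
      #solutions * (q * δ) + q * r ∎
      where
      by-multiplicity : ∑ xs column′ ≡ (∑[ a ∈ xs ] ∑[ b ∈ xs ] multiplicity a b * g a b)
      by-multiplicity = begin
        (∑[ y ∈ xs ] ∑[ a ∈ xs ] ∑[ b ∈ xs ] incidence y a b * g a b)
          ≡⟨ ∑-comm xs xs _ ⟩
        (∑[ a ∈ xs ] ∑[ y ∈ xs ] ∑[ b ∈ xs ] incidence y a b * g a b)
          ≡⟨ ∑-cong xs (λ a → ∑-comm xs xs _) ⟩
        (∑[ a ∈ xs ] ∑[ b ∈ xs ] ∑[ y ∈ xs ] incidence y a b * g a b)
          ≡⟨ ∑-cong xs (λ a → ∑-cong xs (λ b → ∑-*ʳ xs (g a b) _)) ⟩
        (∑[ a ∈ xs ] ∑[ b ∈ xs ] multiplicity a b * g a b) ∎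
      qδ≡∑δ : q * δ ≡ (∑[ _ ∈ xs ] δ)
      qδ≡∑δ = sym (trans (∑-const xs δ) (cong (_* δ) (length-allBits m)))
      row : ∀ a → (∑[ b ∈ xs ] multiplicity a b * g a b) + δ ≡ 𝟙[ (a ⋆ d₂) ≟ d₁ ] * (q * δ) + r
      row a = begin
        (∑[ b ∈ xs ] multiplicity a b * g a b) + δ
          ≡⟨ cong ((∑[ b ∈ xs ] multiplicity a b * g a b) +_) (g-diagonal a) ⟨
        (∑[ b ∈ xs ] multiplicity a b * g a b) + g a a
          ≡⟨ ∑-split a _ (g a) off-diagonal ⟩
        multiplicity a a * g a a + ∑ xs (g a)
          ≡⟨ cong₂ _+_ (cong₂ _*_ (multiplicity-diagonal a) (g-diagonal a)) (∑ᵇ-g a) ⟩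
        q * 𝟙[ (a ⋆ d₂) ≟ d₁ ] * δ + r
          ≡⟨ cong (_+ r) (reorder q 𝟙[ (a ⋆ d₂) ≟ d₁ ] δ) ⟩
        𝟙[ (a ⋆ d₂) ≟ d₁ ] * (q * δ) + r ∎
        where
        off-diagonal : ∀ b → b ≢ a → multiplicity a b * g a b ≡ g a b
        off-diagonal b b≢a = trans (cong (_* g a b) (multiplicity-offdiagonal b≢a)) (*-identityˡ (g a b))
        reorder : ∀ x y z → x * y * z ≡ y * (x * z)
        reorder = solve-∀

    ∑∑-indicatorᵇ : (e : Bits m → ℕ) → (∑[ a ∈ xs ] ∑[ b ∈ xs ] e b * g a b) ≡ ∑ xs e * r
    ∑∑-indicatorᵇ e = begin
      (∑[ a ∈ xs ] ∑[ b ∈ xs ] e b * g a b)    ≡⟨ ∑-comm xs xs _ ⟩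
      (∑[ b ∈ xs ] ∑[ a ∈ xs ] e b * g a b)    ≡⟨ ∑-cong xs (λ b → ∑-*ˡ xs (e b) (λ a → g a b)) ⟩
      (∑[ b ∈ xs ] e b * (∑[ a ∈ xs ] g a b))  ≡⟨ ∑-cong xs (λ b → cong (e b *_) (∑ᵃ-g b)) ⟩
      (∑[ b ∈ xs ] e b * r)                    ≡⟨ ∑-*ʳ xs r e ⟩
      ∑ xs e * r                               ∎

    ∑∑-indicatorᵃ : (e : Bits m → ℕ) → (∑[ a ∈ xs ] ∑[ b ∈ xs ] e a * g a b) ≡ ∑ xs e * r
    ∑∑-indicatorᵃ e = begin
      (∑[ a ∈ xs ] ∑[ b ∈ xs ] e a * g a b)    ≡⟨ ∑-cong xs (λ a → ∑-*ˡ xs (e a) (g a)) ⟩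
      (∑[ a ∈ xs ] e a * ∑ xs (g a))           ≡⟨ ∑-cong xs (λ a → cong (e a *_) (∑ᵇ-g a)) ⟩
      (∑[ a ∈ xs ] e a * r)                    ≡⟨ ∑-*ʳ xs r e ⟩
      ∑ xs e * r                               ∎

    column-at-root : ∀ {y} → y ≢ 𝟘 → y ⊕ d₂ ≡ 𝟘 → column y ≡ r
    column-at-root {y} y≢𝟘 y⊕d₂≡𝟘 = begin
      column y
        ≡⟨ ∑-cong xs (λ x → cong (g (x ÷ y)) (÷-by-𝟘 (x ⊕ d₁) y⊕d₂≡𝟘)) ⟩
      (∑[ x ∈ xs ] g (x ÷ y) 𝟘)
        ≡⟨ ∑-reindex (_÷ y) (÷-injective y≢𝟘) (λ a → g a 𝟘) ⟩
      (∑[ a ∈ xs ] g a 𝟘)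
        ≡⟨ ∑ᵃ-g 𝟘 ⟩
      r ∎

    column′-at-root : ∀ {y} → y ≢ 𝟘 → y ⊕ d₂ ≡ 𝟘 → column′ y ≡ r
    column′-at-root {y} y≢𝟘 y⊕d₂≡𝟘 = begin
      column′ y
        ≡⟨ ∑-cong xs (λ a → ∑-cong xs (λ b → cong (_* g a b)
             (𝟙-cong ((b ⋆ (y ⊕ d₂)) ≟ ((a ⋆ y) ⊕ d₁)) ((a ⋆ y) ≟ d₁) (to a b) (from a b)))) ⟩
      (∑[ a ∈ xs ] ∑[ b ∈ xs ] 𝟙[ (a ⋆ y) ≟ d₁ ] * g a b)
        ≡⟨ ∑∑-indicatorᵃ (λ a → 𝟙[ (a ⋆ y) ≟ d₁ ]) ⟩
      (∑[ a ∈ xs ] 𝟙[ (a ⋆ y) ≟ d₁ ]) * r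
        ≡⟨ cong (_* r) (#⋆-solutions y≢𝟘 d₁) ⟩
      1 * r
        ≡⟨ *-identityˡ r ⟩
      r ∎
      where
      b⋆[y⊕d₂]≡𝟘 : ∀ b → b ⋆ (y ⊕ d₂) ≡ 𝟘
      b⋆[y⊕d₂]≡𝟘 b = trans (cong (b ⋆_) y⊕d₂≡𝟘) (zero-right b)
      to : ∀ a b → b ⋆ (y ⊕ d₂) ≡ (a ⋆ y) ⊕ d₁ → a ⋆ y ≡ d₁
      to a b e = ⊕≡𝟘⇒≡ (trans (sym e) (b⋆[y⊕d₂]≡𝟘 b))
      from : ∀ a b → a ⋆ y ≡ d₁ → b ⋆ (y ⊕ d₂) ≡ (a ⋆ y) ⊕ d₁
      from a b e = trans (b⋆[y⊕d₂]≡𝟘 b) (sym (≡⇒⊕≡𝟘 e))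

    module NonHorizontal (d₂≢𝟘 : d₂ ≢ 𝟘) where

      𝟘⊕d₂≢𝟘 : 𝟘 ⊕ d₂ ≢ 𝟘
      𝟘⊕d₂≢𝟘 e = d₂≢𝟘 (trans (sym (⊕-identityˡ d₂)) e)

      column-𝟘 : column 𝟘 ≡ r
      column-𝟘 = begin
        column 𝟘
          ≡⟨ ∑-cong xs (λ x → cong (λ a → g a ((x ⊕ d₁) ÷ (𝟘 ⊕ d₂))) (÷-by-𝟘 x refl)) ⟩
        (∑[ x ∈ xs ] g 𝟘 ((x ⊕ d₁) ÷ (𝟘 ⊕ d₂)))
          ≡⟨ ∑-reindex (λ x → (x ⊕ d₁) ÷ (𝟘 ⊕ d₂)) (λ e → ⊕-cancelʳ (÷-injective 𝟘⊕d₂≢𝟘 e)) (g 𝟘) ⟩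
        ∑ xs (g 𝟘)
          ≡⟨ ∑ᵇ-g 𝟘 ⟩
        r ∎

      column′-𝟘 : column′ 𝟘 ≡ r
      column′-𝟘 = begin
        column′ 𝟘
          ≡⟨ ∑-cong xs (λ a → ∑-cong xs (λ b →
               cong (λ z → 𝟙[ (b ⋆ (𝟘 ⊕ d₂)) ≟ (z ⊕ d₁) ] * g a b) (zero-right a))) ⟩
        (∑[ a ∈ xs ] ∑[ b ∈ xs ] e b * g a b)
          ≡⟨ ∑∑-indicatorᵇ e ⟩
        ∑ xs e * r
          ≡⟨ cong (_* r) (#⋆-solutions 𝟘⊕d₂≢𝟘 (𝟘 ⊕ d₁)) ⟩
        1 * r
          ≡⟨ *-identityˡ r ⟩
        r ∎
        where
        e : Bits m → ℕ
        e b = 𝟙[ (b ⋆ (𝟘 ⊕ d₂)) ≟ (𝟘 ⊕ d₁) ]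

      column≡column′-everywhere : ∀ y → column y ≡ column′ y
      column≡column′-everywhere y = by-cases (y ≟ 𝟘) ((y ⊕ d₂) ≟ 𝟘)
        where
        by-cases : Dec (y ≡ 𝟘) → Dec (y ⊕ d₂ ≡ 𝟘) → column y ≡ column′ y
        by-cases (yes y≡𝟘) _             =
          trans (cong column y≡𝟘) (trans column-𝟘 (sym (trans (cong column′ y≡𝟘) column′-𝟘)))
        by-cases (no y≢𝟘)  (yes y⊕d₂≡𝟘) =
          trans (column-at-root y≢𝟘 y⊕d₂≡𝟘) (sym (column′-at-root y≢𝟘 y⊕d₂≡𝟘))
        by-cases (no y≢𝟘)  (no y⊕d₂≢𝟘)  = column≡column′ y≢𝟘 y⊕d₂≢𝟘

      ∑column≡qr : ∑ xs column ≡ q * r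
      ∑column≡qr = +-cancelʳ-≡ (q * δ) _ _ (begin
        ∑ xs column + q * δ             ≡⟨ cong (_+ q * δ) (∑-cong xs column≡column′-everywhere) ⟩
        ∑ xs column′ + q * δ            ≡⟨ ∑column′ ⟩
        #solutions * (q * δ) + q * r    ≡⟨ cong (λ n → n * (q * δ) + q * r) (#⋆-solutions d₂≢𝟘 d₁) ⟩
        1 * (q * δ) + q * r             ≡⟨ cong (_+ q * r) (*-identityˡ (q * δ)) ⟩
        q * δ + q * r                   ≡⟨ +-comm (q * δ) (q * r) ⟩
        q * r + q * δ                   ∎)

    module Horizontal (d₂≡𝟘 : d₂ ≡ 𝟘) (d₁≢𝟘 : d₁ ≢ 𝟘) where

      column-𝟘 : column 𝟘 ≡ q * δ
      column-𝟘 = begin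
        column 𝟘
          ≡⟨ ∑-cong xs (λ x → trans (cong₂ g (÷-by-𝟘 x refl) (÷-by-𝟘 (x ⊕ d₁) 𝟘⊕d₂≡𝟘)) (g-diagonal 𝟘)) ⟩
        (∑[ _ ∈ xs ] δ)
          ≡⟨ ∑-const xs δ ⟩
        length xs * δ
          ≡⟨ cong (_* δ) (length-allBits m) ⟩
        q * δ ∎
        where
        𝟘⊕d₂≡𝟘 : 𝟘 ⊕ d₂ ≡ 𝟘
        𝟘⊕d₂≡𝟘 = trans (⊕-identityˡ d₂) d₂≡𝟘

      column′-𝟘 : column′ 𝟘 ≡ 0
      column′-𝟘 = ∑-zero xs (λ a → ∑-zero xs (λ b →
        cong (_* g a b) (𝟙-no ((b ⋆ (𝟘 ⊕ d₂)) ≟ ((a ⋆ 𝟘) ⊕ d₁)) (never a b))))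
        where
        never : ∀ a b → b ⋆ (𝟘 ⊕ d₂) ≢ (a ⋆ 𝟘) ⊕ d₁
        never a b e = d₁≢𝟘 (begin
          d₁               ≡⟨ ⊕-identityˡ d₁ ⟨
          𝟘 ⊕ d₁           ≡⟨ cong (_⊕ d₁) (zero-right a) ⟨
          (a ⋆ 𝟘) ⊕ d₁     ≡⟨ e ⟨
          b ⋆ (𝟘 ⊕ d₂)     ≡⟨ cong (λ z → b ⋆ (𝟘 ⊕ z)) d₂≡𝟘 ⟩
          b ⋆ (𝟘 ⊕ 𝟘)      ≡⟨ cong (b ⋆_) (⊕-self 𝟘) ⟩
          b ⋆ 𝟘            ≡⟨ zero-right b ⟩
          𝟘                ∎)

      no-solutions : #solutions ≡ 0
      no-solutions = ∑-zero xs (λ a → 𝟙-no _ (λ e →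
        d₁≢𝟘 (trans (sym e) (trans (cong (a ⋆_) d₂≡𝟘) (zero-right a)))))

      ∑column≡qr : ∑ xs column ≡ q * r
      ∑column≡qr = begin
        ∑ xs column
          ≡⟨ +-identityʳ _ ⟨
        ∑ xs column + 0
          ≡⟨ cong (∑ xs column +_) column′-𝟘 ⟨
        ∑ xs column + column′ 𝟘
          ≡⟨ ∑-split 𝟘 column column′ (λ y y≢𝟘 → column≡column′ y≢𝟘 (y⊕d₂≢𝟘 y≢𝟘)) ⟩
        column 𝟘 + ∑ xs column′
          ≡⟨ cong (_+ ∑ xs column′) column-𝟘 ⟩
        q * δ + ∑ xs column′
          ≡⟨ +-comm (q * δ) _ ⟩
        ∑ xs column′ + q * δ
          ≡⟨ ∑column′ ⟩
        #solutions * (q * δ) + q * r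
          ≡⟨ cong (λ n → n * (q * δ) + q * r) no-solutions ⟩
        q * r ∎
        where
        y⊕d₂≢𝟘 : ∀ {y} → y ≢ 𝟘 → y ⊕ d₂ ≢ 𝟘
        y⊕d₂≢𝟘 {y} y≢𝟘 e = y≢𝟘 (trans (sym (⊕-identityʳ y)) (trans (cong (y ⊕_) (sym d₂≡𝟘)) e))

  derivative-balanced : ∀ d → d ≢ (𝟘 , 𝟘) → ∀ w →
                        (∑[ u ∈ allDom m ] 𝟙[ (f u ⊕ f (u ⊕D d)) ≟ w ]) ≡ q * r
  derivative-balanced (d₁ , d₂) d≢𝟘 w = trans (∑-allDom-by-columns m _) (by-cases (d₂ ≟ 𝟘))
    where
    open Derivative d₁ d₂ w
    by-cases : Dec (d₂ ≡ 𝟘) → ∑ xs column ≡ q * r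
    by-cases (yes d₂≡𝟘) = Horizontal.∑column≡qr d₂≡𝟘 (λ d₁≡𝟘 → d≢𝟘 (cong₂ _,_ d₁≡𝟘 d₂≡𝟘))
    by-cases (no d₂≢𝟘)  = NonHorizontal.∑column≡qr d₂≢𝟘

  module SecondMoment (A L : Dom m → Bits t) (c : Bits t)
    (L-additive : ∀ u v → L (u ⊕D v) ≡ L u ⊕ L v) (A≗L⊕c : ∀ u → A u ≡ L u ⊕ c) where
    open ≡-Reasoning

    D : List (Dom m)
    D = allDom m

    T : List (Bits t)
    T = allBits t

    G : Dom m → Bits t
    G u = f u ⊕ L u

    N : Bits t → ℕ
    N w = ∑[ u ∈ D ] 𝟙[ G u ≟ w ]

    agreements≡N : agreements f A ≡ N c
    agreements≡N = ∑-cong D (λ u → 𝟙-cong (f u ≟ A u) (G u ≟ c)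
      (λ e → ⊕-moveʳ⁻¹ (trans e (trans (A≗L⊕c u) (⊕-comm (L u) c))))
      (λ e → trans (⊕-moveʳ e) (trans (⊕-comm c (L u)) (sym (A≗L⊕c u)))))

    ∑N : ∑ T N ≡ q * q
    ∑N = trans (Bitsₑ.∑-fibres t D G) (length-allDom m)

    derivative : Dom m → ℕ
    derivative d = ∑[ u ∈ D ] 𝟙[ (f u ⊕ f (u ⊕D d)) ≟ L d ]

    collision⇔derivative : ∀ u d → 𝟙[ G (u ⊕D d) ≟ G u ] ≡ 𝟙[ (f u ⊕ f (u ⊕D d)) ≟ L d ]
    collision⇔derivative u d = 𝟙-cong (G (u ⊕D d) ≟ G u) ((f u ⊕ f (u ⊕D d)) ≟ L d)
      (λ e → trans (⊕-comm (f u) _) (trans (⊕-exchange e) L[u⊕d]⊕Lu≡Ld))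
      (λ e → ⊕-exchange (trans (⊕-comm _ (f u)) (trans e (sym L[u⊕d]⊕Lu≡Ld))))
      where
      L[u⊕d]⊕Lu≡Ld : L (u ⊕D d) ⊕ L u ≡ L d
      L[u⊕d]⊕Lu≡Ld = trans (cong (_⊕ L u) (L-additive u d)) (⊕-moveʳ⁻¹ (⊕-comm (L u) (L d)))

    ∑N²≡∑derivative : (∑[ w ∈ T ] N w * N w) ≡ ∑ D derivative
    ∑N²≡∑derivative = begin
      (∑[ w ∈ T ] N w * N w)
        ≡⟨ ∑-cong T (λ w → ∑-*ʳ D (N w) _) ⟨
      (∑[ w ∈ T ] ∑[ u ∈ D ] 𝟙[ G u ≟ w ] * N w)
        ≡⟨ ∑-comm T D _ ⟩
      (∑[ u ∈ D ] ∑[ w ∈ T ] 𝟙[ G u ≟ w ] * N w)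
        ≡⟨ ∑-cong D (λ u → Bitsₑ.∑-pick′ t (G u) N) ⟩
      (∑[ u ∈ D ] ∑[ v ∈ D ] 𝟙[ G v ≟ G u ])
        ≡⟨ ∑-cong D (λ u → Domₑ.∑-reindex m (u ⊕D_) (⊕D-cancelˡ u) _) ⟨
      (∑[ u ∈ D ] ∑[ d ∈ D ] 𝟙[ G (u ⊕D d) ≟ G u ])
        ≡⟨ ∑-comm D D _ ⟩
      (∑[ d ∈ D ] ∑[ u ∈ D ] 𝟙[ G (u ⊕D d) ≟ G u ])
        ≡⟨ ∑-cong D (λ d → ∑-cong D (λ u → collision⇔derivative u d)) ⟩
      ∑ D derivative ∎

    derivative-𝟘 : derivative (𝟘 , 𝟘) ≡ q * q
    derivative-𝟘 = trans (∑𝟙-everywhere _ D f[u]⊕f[u]≡L𝟘) (length-allDom m)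
      where
      L𝟘≡𝟘 : L (𝟘 , 𝟘) ≡ 𝟘
      L𝟘≡𝟘 = trans (cong L (sym (cong₂ _,_ (⊕-self 𝟘) (⊕-self 𝟘))))
                   (trans (L-additive (𝟘 , 𝟘) (𝟘 , 𝟘)) (⊕-self (L (𝟘 , 𝟘))))
      f[u]⊕f[u]≡L𝟘 : ∀ u → f u ⊕ f (u ⊕D (𝟘 , 𝟘)) ≡ L (𝟘 , 𝟘)
      f[u]⊕f[u]≡L𝟘 u = trans (cong (λ v → f u ⊕ f v) (⊕D-identityʳ u)) (trans (⊕-self (f u)) (sym L𝟘≡𝟘))

    ∑N² : (∑[ w ∈ T ] N w * N w) + q * r ≡ q * q + q * q * (q * r)
    ∑N² = begin
      (∑[ w ∈ T ] N w * N w) + q * r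
        ≡⟨ cong (_+ q * r) ∑N²≡∑derivative ⟩
      ∑ D derivative + q * r
        ≡⟨ Domₑ.∑-const-except m (𝟘 , 𝟘) derivative (q * r) (λ d d≢𝟘 → derivative-balanced d d≢𝟘 (L d)) ⟩
      derivative (𝟘 , 𝟘) + length D * (q * r)
        ≡⟨ cong₂ (λ a b → a + b * (q * r)) derivative-𝟘 (length-allDom m) ⟩
      q * q + q * q * (q * r) ∎

    weight : Bits t → ℕ
    weight w = 𝟙[ ¬? (w ≟ c) ]

    ∑-off-c : ∀ (F : Bits t → ℕ) → (∑[ w ∈ T ] weight w * F w) + F c ≡ ∑ T F
    ∑-off-c F = begin
      (∑[ w ∈ T ] weight w * F w) + F c
        ≡⟨ cong ((∑[ w ∈ T ] weight w * F w) +_) (Bitsₑ.∑-pick t c F) ⟨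
      (∑[ w ∈ T ] weight w * F w) + (∑[ w ∈ T ] 𝟙[ w ≟ c ] * F w)
        ≡⟨ ∑-distrib-+ T _ _ ⟨
      (∑[ w ∈ T ] weight w * F w + 𝟙[ w ≟ c ] * F w)
        ≡⟨ ∑-cong T (λ w → *-distribʳ-+ (F w) (weight w) _) ⟨
      (∑[ w ∈ T ] (weight w + 𝟙[ w ≟ c ]) * F w)
        ≡⟨ ∑-cong T (λ w → cong (_* F w) (𝟙[¬]+𝟙≡1 (w ≟ c))) ⟩
      (∑[ w ∈ T ] F w + 0)
        ≡⟨ ∑-cong T (λ w → +-identityʳ (F w)) ⟩
      ∑ T F ∎

    [1+∑weight]*r≡q : suc (∑ T weight) * r ≡ q
    [1+∑weight]*r≡q = trans (cong (_* r) 1+∑weight≡s) s*r≡q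
      where
      1+∑weight≡s : suc (∑ T weight) ≡ s
      1+∑weight≡s = begin
        suc (∑ T weight)                  ≡⟨ +-comm 1 _ ⟩
        ∑ T weight + 1                    ≡⟨ cong (_+ 1) (∑-cong T (λ w → *-identityʳ (weight w))) ⟨
        (∑[ w ∈ T ] weight w * 1) + 1     ≡⟨ ∑-off-c (λ _ → 1) ⟩
        (∑[ _ ∈ T ] 1)                    ≡⟨ ∑-one T ⟩
        length T                          ≡⟨ length-allBits t ⟩
        s                                 ∎

    agreements-bound : agreements f A + r ≤ q + q * r
    agreements-bound = subst (λ n → n + r ≤ q + q * r) (sym agreements≡N)
      (second-moment-bound (∑ T weight) r q (N c)
        (∑[ w ∈ T ] weight w * N w) (∑[ w ∈ T ] weight w * (N w * N w))
        [1+∑weight]*r≡q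
        (trans (∑-off-c N) ∑N)
        (trans (cong (_+ q * r) (∑-off-c (λ w → N w * N w))) ∑N²)
        (cauchy-schwarz T weight N))

  distToAffine : DistToAffine f (targetValue m t)
  distToAffine = distToAffine-fromAgreements f (λ _ → γ 𝟘) (const-isAffine (γ 𝟘)) agreements-const
    (λ { A (L , c , (L-additive , _) , A≗L⊕c) → SecondMoment.agreements-bound A L c L-additive A≗L⊕c })

module F₂ (m t : ℕ) (t≤m : t ≤ m)
  {_⋆_ : Bits m → Bits m → Bits m} (Q : IsLeftPreQuasifield m _⋆_)
  (τ h : Bits m → Bits t) (σ : Bits m → Bits m)
  (τ-surjective : Surjective τ) (τ-linear : IsF2Linear τ) (σ-invertible : Invertible σ) where

  open Sizes m t t≤m
  open LeftPreQuasifield Q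
  open Bitsₑ m using (∑-reindex; ∑-const-except)

  f : Dom m → Bits t
  f = f₂ _⋆_ τ σ h

  xs : List (Bits m)
  xs = allBits m

  τ-additive : ∀ x y → τ (x ⊕ y) ≡ τ x ⊕ τ y
  τ-additive = proj₁ τ-linear

  #τ⊕v≡w : ∀ v w → (∑[ z ∈ xs ] 𝟙[ (τ z ⊕ v) ≟ w ]) ≡ r
  #τ⊕v≡w v w = trans (∑-cong xs (λ z → 𝟙-⊕-move (τ z) v w))
    (balanced⇒#preimage t≤m τ (AdditiveMap.surjective⇒balanced τ τ-additive τ-surjective) (w ⊕ v))

  σ⁻¹ : Bits m → Bits m
  σ⁻¹ = proj₁ σ-invertible

  σ-injective : Injective _≡_ _≡_ σ
  σ-injective {x} {y} e = begin
    x           ≡⟨ proj₁ (proj₂ σ-invertible) x ⟨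
    σ⁻¹ (σ x)   ≡⟨ cong σ⁻¹ e ⟩
    σ⁻¹ (σ y)   ≡⟨ proj₁ (proj₂ σ-invertible) y ⟩
    y           ∎
    where open ≡-Reasoning

  τ𝟘≡𝟘 : τ 𝟘 ≡ 𝟘
  τ𝟘≡𝟘 = additive⇒𝟘↦𝟘 τ τ-additive

  y₀ : Bits m
  y₀ = σ⁻¹ 𝟘

  σy₀≡𝟘 : σ y₀ ≡ 𝟘
  σy₀≡𝟘 = proj₂ (proj₂ σ-invertible) 𝟘

  agreements-const : agreements f (λ _ → h y₀) + r ≡ q + q * r
  agreements-const = begin
    agreements f (λ _ → h y₀) + r  ≡⟨ cong (_+ r) (∑-allDom-by-columns m _) ⟩
    ∑ xs column + r               ≡⟨ ∑-const-except y₀ column r column-r ⟩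
    column y₀ + length xs * r     ≡⟨ cong₂ (λ a b → a + b * r) column-y₀ (length-allBits m) ⟩
    q + q * r                     ∎
    where
    open ≡-Reasoning
    column : Bits m → ℕ
    column y = ∑[ x ∈ xs ] 𝟙[ (τ (σ y ⋆ x) ⊕ h y) ≟ h y₀ ]
    column-r : ∀ y → y ≢ y₀ → column y ≡ r
    column-r y y≢y₀ = trans (∑-reindex (σ y ⋆_) (⋆-cancelˡ (σ y) σy≢𝟘) (λ z → 𝟙[ (τ z ⊕ h y) ≟ h y₀ ]))
                            (#τ⊕v≡w (h y) (h y₀))
      where
      σy≢𝟘 : σ y ≢ 𝟘
      σy≢𝟘 σy≡𝟘 = y≢y₀ (σ-injective (trans σy≡𝟘 (sym σy₀≡𝟘)))
    column-y₀ : column y₀ ≡ q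
    column-y₀ = trans (∑𝟙-everywhere _ xs agrees) (length-allBits m)
      where
      agrees : ∀ x → τ (σ y₀ ⋆ x) ⊕ h y₀ ≡ h y₀
      agrees x = begin
        τ (σ y₀ ⋆ x) ⊕ h y₀  ≡⟨ cong (λ b → τ (b ⋆ x) ⊕ h y₀) σy₀≡𝟘 ⟩
        τ (𝟘 ⋆ x) ⊕ h y₀     ≡⟨ cong (λ z → τ z ⊕ h y₀) (zero-left x) ⟩
        τ 𝟘 ⊕ h y₀           ≡⟨ cong (_⊕ h y₀) τ𝟘≡𝟘 ⟩
        𝟘 ⊕ h y₀             ≡⟨ ⊕-identityˡ (h y₀) ⟩
        h y₀                 ∎

  module AgreementsWithAffine (A L : Dom m → Bits t) (c : Bits t)
    (L-additive : ∀ u v → L (u ⊕D v) ≡ L u ⊕ L v) (A≗L⊕c : ∀ u → A u ≡ L u ⊕ c) where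
    open ≡-Reasoning

    L₁ L₂ : Bits m → Bits t
    L₁ x = L (x , 𝟘)
    L₂ y = L (𝟘 , y)

    L₁-additive : ∀ x x′ → L₁ (x ⊕ x′) ≡ L₁ x ⊕ L₁ x′
    L₁-additive x x′ = trans (cong (λ z → L (x ⊕ x′ , z)) (sym (⊕-self 𝟘))) (L-additive (x , 𝟘) (x′ , 𝟘))

    A≡L₁⊕L₂⊕c : ∀ x y → A (x , y) ≡ L₁ x ⊕ (L₂ y ⊕ c)
    A≡L₁⊕L₂⊕c x y = begin
      A (x , y)               ≡⟨ A≗L⊕c (x , y) ⟩
      L (x , y) ⊕ c           ≡⟨ cong (λ u → L u ⊕ c) (cong₂ _,_ (⊕-identityʳ x) (⊕-identityˡ y)) ⟨
      L (x ⊕ 𝟘 , 𝟘 ⊕ y) ⊕ c   ≡⟨ cong (_⊕ c) (L-additive (x , 𝟘) (𝟘 , y)) ⟩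
      (L₁ x ⊕ L₂ y) ⊕ c       ≡⟨ ⊕-assoc (L₁ x) (L₂ y) c ⟩
      L₁ x ⊕ (L₂ y ⊕ c)       ∎

    M : Bits m → Bits m → Bits t
    M b x = τ (b ⋆ x) ⊕ L₁ x

    M-additive : ∀ b x x′ → M b (x ⊕ x′) ≡ M b x ⊕ M b x′
    M-additive b x x′ = trans
      (cong₂ _⊕_ (trans (cong τ (distrib-left b x x′)) (τ-additive _ _)) (L₁-additive x x′))
      (⊕-interchange _ _ _ _)

    w : Bits m → Bits t
    w y = h y ⊕ (L₂ y ⊕ c)

    agrees⇔M≡w : ∀ y x → 𝟙[ f (x , y) ≟ A (x , y) ] ≡ 𝟙[ M (σ y) x ≟ w y ]
    agrees⇔M≡w y x = 𝟙-cong _ _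
      (λ e → ⊕-exchange (trans e (A≡L₁⊕L₂⊕c x y)))
      (λ e → trans (⊕-exchange e) (sym (A≡L₁⊕L₂⊕c x y)))

    #kernel : Bits m → ℕ
    #kernel b = #preimage (M b) 𝟘

    column≤#kernel : ∀ y → #preimage (M (σ y)) (w y) ≤ #kernel (σ y)
    column≤#kernel y = AdditiveMap.#preimage≤#kernel (M (σ y)) (M-additive (σ y)) (w y)

    #roots : Bits m → ℕ
    #roots x = ∑[ b ∈ xs ] 𝟙[ M b x ≟ 𝟘 ]

    #roots-r : ∀ x → x ≢ 𝟘 → #roots x ≡ r
    #roots-r x x≢𝟘 = trans (∑-reindex (_⋆ x) (⋆-cancelʳ x x≢𝟘) (λ z → 𝟙[ (τ z ⊕ L₁ x) ≟ 𝟘 ]))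
                           (#τ⊕v≡w (L₁ x) 𝟘)

    #roots-𝟘 : #roots 𝟘 ≡ q
    #roots-𝟘 = trans (∑𝟙-everywhere _ xs M-b-𝟘) (length-allBits m)
      where
      M-b-𝟘 : ∀ b → M b 𝟘 ≡ 𝟘
      M-b-𝟘 b = begin
        τ (b ⋆ 𝟘) ⊕ L₁ 𝟘
          ≡⟨ cong₂ _⊕_ (trans (cong τ (zero-right b)) τ𝟘≡𝟘) (additive⇒𝟘↦𝟘 L₁ L₁-additive) ⟩
        𝟘 ⊕ 𝟘
          ≡⟨ ⊕-self 𝟘 ⟩
        𝟘 ∎

  agreements-bound : ∀ A → IsAffine A → agreements f A + r ≤ q + q * r
  agreements-bound A (L , c , (L-additive , _) , A≗L⊕c) = begin
    agreements f A + r
      ≡⟨ cong (_+ r) (∑-allDom-by-columns m _) ⟩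
    (∑[ y ∈ xs ] ∑[ x ∈ xs ] 𝟙[ f (x , y) ≟ A (x , y) ]) + r
      ≡⟨ cong (_+ r) (∑-cong xs (λ y → ∑-cong xs (agrees⇔M≡w y))) ⟩
    (∑[ y ∈ xs ] #preimage (M (σ y)) (w y)) + r
      ≤⟨ +-monoˡ-≤ r (∑-mono-≤ xs column≤#kernel) ⟩
    (∑[ y ∈ xs ] #kernel (σ y)) + r
      ≡⟨ cong (_+ r) (∑-reindex σ σ-injective #kernel) ⟩
    (∑[ b ∈ xs ] #kernel b) + r
      ≡⟨ cong (_+ r) (∑-comm xs xs (λ b x → 𝟙[ M b x ≟ 𝟘 ])) ⟩
    ∑ xs #roots + r
      ≡⟨ ∑-const-except 𝟘 #roots r #roots-r ⟩
    #roots 𝟘 + length xs * r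
      ≡⟨ cong₂ (λ a b → a + b * r) #roots-𝟘 (length-allBits m) ⟩
    q + q * r ∎
    where
    open ≤-Reasoning
    open AgreementsWithAffine A L c L-additive A≗L⊕c

  distToAffine : DistToAffine f (targetValue m t)
  distToAffine = distToAffine-fromAgreements f (λ _ → h y₀) (const-isAffine (h y₀))
    agreements-const agreements-bound

theorem1 : (m t : ℕ) → .{{_ : NonZero t}} → t ≤ m →
    (_⋆_ : Bits m → Bits m → Bits m) → IsLeftPreQuasifield m _⋆_ →
    (γ τ h : Bits m → Bits t) (σ : Bits m → Bits m) →
    Balanced γ → Surjective τ → IsF2Linear τ → Invertible σ →
    DistToAffine (f₁ _⋆_ γ) (targetValue m t) ×
    DistToAffine (f₂ _⋆_ τ σ h) (targetValue m t)
theorem1 m t t≤m _⋆_ Q γ τ h σ γ-balanced τ-surjective τ-linear σ-invertible =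
  F₁.distToAffine m t t≤m Q γ γ-balanced ,
  F₂.distToAffine m t t≤m Q τ h σ τ-surjective τ-linear σ-invertible
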